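{- Let $\pi\in G_{r,n}$ be not monochromatic, let $i$ be the largest index with $\epsilon(\pi(1))=\cdots=\epsilon(\pi(i))$, let $b=\epsilon(\pi(i+1))$, and define $\rho(\pi)\in G_{r,n}$ by $\rho(\pi)(s)=|\pi(s)|_b$ for $1\le s\le i$ and $\rho(\pi)(s)=\pi(s)$ for $i<s\le n$. If $\mathrm{des}(\pi)=\mathrm{des}(\rho(\pi))$, then $\Omega_{P(\pi)}(j)=\Omega_{P(\rho(\pi))}(j)$ for every integer $j\ge0$.
   Context: Fix integers $r\ge1$, $n\ge1$. For a totally ordered set $Y$, $Y_{(r)}=\{0,\dots,r-1\}\times Y$ with the lexicographic order; write $x_k$ for $(k,x)$, $Y_k=\{k\}\times Y$, $|x_k|=x$, $\epsilon(x_k)=k$; color subscripts are read modulo $r$; $[n]=\{1,\dots,n\}$, $[0,n]=\{0,\dots,n\}$. $G_{r,n}$ is the group of bijections $\pi$ of $[n]_{(r)}$ with $\pi(i_j)=k_l\Rightarrow\pi(i_{j+a})=k_{l+a}$ (mod $r$), written in one-line notation $\pi(1)\cdots\pi(n)$, $\pi(i)=\pi(i_0)$. $\mathrm{Des}(\pi)=\{i\in[n]:\pi(i)>\pi(i+1)\}$ (order of $[0,n]_{(r)}$, with $\pi(n+1)=0_1$), $\mathrm{des}(\pi)=|\mathrm{Des}(\pi)|$. An $r$-colored poset is a finite set $P=\{0_1,\dots,0_{r-1}\}\cup Q$, $Q\subseteq[n]_{(r)}$ with distinct absolute values, with partial order $\prec$ such that $0_1\prec\cdots\prec0_{r-1}$.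 With $X=[0,j]$, a colored $P$-partition is a map $f:P\to X_{(r)}$ with (i) $f(0_k)=(k,0)$; (ii) $a\prec b\Rightarrow f(a)\le f(b)$; (iii) if $a\prec b$, $f(a),f(b)\in X_k$ for the same $k$, and $|a|_{\epsilon(a)-k}>|b|_{\epsilon(b)-k}$ in $[0,n]_{(r)}$, then $f(a)<f(b)$; (iv) if $f(a)=(k,j)$ then $\epsilon(a)=k$. $\Omega_P(j)$ is the number of such $f$. For $\pi\in G_{r,n}$, $P(\pi)$ is the disjoint union of the chains $0_1\prec\cdots\prec0_{r-1}$ and $\pi(1)\prec\cdots\prec\pi(n)$. -}

module Defs where

open import Data.Nat using (ℕ; zero; suc; _+_; _∸_; _<_; _≤_; _<?_; NonZero)
open import Data.Nat.Properties using (_≟_)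
open import Data.Nat.DivMod using (_%_)
open import Data.Fin using (Fin; toℕ; fromℕ<)
open import Data.Fin.Permutation using (Permutation′; _⟨$⟩ʳ_)
import Data.Fin.Properties as FinP
open import Data.Product using (_×_; _,_; proj₁; proj₂; Σ)
open import Data.Product.Properties using (≡-dec)
open import Data.Sum using (_⊎_; inj₁; inj₂)
open import Data.List using (List; []; _∷_; map; concatMap; filter; length; cartesianProduct; upTo; allFin)
open import Data.Vec.Functional as VF using (Vector)
open import Data.Empty using (⊥)
open import Relation.Nullary using (Dec; yes; no; ¬_)
open import Relation.Nullary.Decidable using (_×-dec_; _⊎-dec_; _→-dec_)
open import Relation.Binary.PropositionalEquality using (_≡_)

-- Colored elements x_k are encoded as pairs (k , x) : ℕ × ℕ
-- (colour first).  The order on Y_(r) is lexicographic.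

_<ℓ_ : ℕ × ℕ → ℕ × ℕ → Set
(k , x) <ℓ (l , y) = (k < l) ⊎ ((k ≡ l) × (x < y))

_≤ℓ_ : ℕ × ℕ → ℕ × ℕ → Set
p ≤ℓ q = (p <ℓ q) ⊎ (p ≡ q)

_<ℓ?_ : (p q : ℕ × ℕ) → Dec (p <ℓ q)
(k , x) <ℓ? (l , y) = (k <? l) ⊎-dec ((k ≟ l) ×-dec (x <? y))

_≤ℓ?_ : (p q : ℕ × ℕ) → Dec (p ≤ℓ q)
p ≤ℓ? q = (p <ℓ? q) ⊎-dec ≡-dec _≟_ _≟_ p q

-- The coloured permutation group G_{r,n}, via one-line notation:
-- π(i) = (colour i , |π(i)|), with i ↦ |π(i)| a permutation of [n].

record ColPerm (r n : ℕ) : Set where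
  field
    colour : Fin n → Fin r
    absP   : Permutation′ n

open ColPerm public

-- value π(s+1) for the 0-indexed position s, as an element of [n]_(r)
val : ∀ {r n} → ColPerm r n → Fin n → ℕ × ℕ
val π s = toℕ (colour π s) , suc (toℕ (absP π ⟨$⟩ʳ s))

-- the element 0_1 (colour subscript read mod r)
zero₁ : (r : ℕ) .{{_ : NonZero r}} → ℕ × ℕ
zero₁ r = (1 % r) , 0

-- π(m+1) for m : ℕ, 0-indexed, with π(n+1) = 0_1
valExt : ∀ {r n} .{{_ : NonZero r}} → ColPerm r n → ℕ → ℕ × ℕ
valExt {r} {n} π m with m <? n
... | yes m<n = val π (fromℕ< m<n)
... | no _    = zero₁ r

des : ∀ {r n} .{{_ : NonZero r}} → ColPerm r n → ℕ
des {r} {n} π = length (filter (λ m → valExt π (suc m) <ℓ? valExt π m) (upTo n))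

Monochromatic : ∀ {r n} → ColPerm r n → Set
Monochromatic π = ∀ s t → colour π s ≡ colour π t

-- ρ(π) given the 0-indexed position k of π(i+1) (so i = toℕ k):
-- the first i letters get the colour b = ε(π(i+1)), the rest unchanged.
rho : ∀ {r n} → ColPerm r n → Fin n → ColPerm r n
rho π k = record
  { colour = λ s → recol s (toℕ s <? toℕ k)
  ; absP   = absP π }
  where
  recol : ∀ s → Dec (toℕ s < toℕ k) → _
  recol s (yes _) = colour π k
  recol s (no _)  = colour π s

-- The coloured poset P(π): elements 0_1,…,0_{r-1} (indexed by Fin (r ∸ 1),
-- t ↦ 0_{t+1}) and π(1),…,π(n) (indexed by position Fin n).

data Elem (r n : ℕ) : Set where
  zeroE  : Fin (r ∸ 1) → Elem r n
  letter : Fin n → Elem r n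

-- the underlying element of [0,n]_(r)  (so ε(a) = proj₁, |a| = proj₂)
lab : ∀ {r n} → ColPerm r n → Elem r n → ℕ × ℕ
lab π (zeroE t) = suc (toℕ t) , 0
lab π (letter s) = val π s

_≺_ : ∀ {r n} → Elem r n → Elem r n → Set
zeroE t ≺ zeroE t′ = toℕ t < toℕ t′
letter s ≺ letter s′ = toℕ s < toℕ s′
_ ≺ _ = ⊥

_≺?_ : ∀ {r n} (a b : Elem r n) → Dec (a ≺ b)
zeroE t ≺? zeroE t′ = toℕ t <? toℕ t′
letter s ≺? letter s′ = toℕ s <? toℕ s′
zeroE _ ≺? letter _ = no (λ ())
letter _ ≺? zeroE _ = no (λ ())

-- |a|_{ε(a) - k}, colour read mod r
shiftBy : (r : ℕ) .{{_ : NonZero r}} → ℕ × ℕ → ℕ → ℕ × ℕ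
shiftBy r (e , x) k = ((e + (r ∸ k)) % r) , x

Cod : ℕ → ℕ → Set
Cod r j = Fin r × Fin (suc j)

toP : ∀ {r j} → Cod r j → ℕ × ℕ
toP (c , v) = toℕ c , toℕ v

record IsColPPartition {r n} .{{_ : NonZero r}} (π : ColPerm r n) (j : ℕ)
                       (f : Elem r n → Cod r j) : Set where
  field
    cond-i   : ∀ t → toP (f (zeroE t)) ≡ (suc (toℕ t) , 0)
    cond-ii  : ∀ a b → a ≺ b → toP (f a) ≤ℓ toP (f b)
    cond-iii : ∀ a b → a ≺ b → proj₁ (f a) ≡ proj₁ (f b) →
               shiftBy r (lab π b) (toℕ (proj₁ (f a)))
                 <ℓ shiftBy r (lab π a) (toℕ (proj₁ (f a))) →
               toP (f a) <ℓ toP (f b)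
    cond-iv  : ∀ a → toℕ (proj₂ (f a)) ≡ j → proj₁ (lab π a) ≡ toℕ (proj₁ (f a))

allElem? : ∀ {r n p} {P : Elem r n → Set p} → (∀ a → Dec (P a)) → Dec (∀ a → P a)
allElem? {P = P} P? with FinP.all? (λ t → P? (zeroE t)) | FinP.all? (λ s → P? (letter s))
... | yes h₁ | yes h₂ = yes λ { (zeroE t) → h₁ t ; (letter s) → h₂ s }
... | no ¬h  | _      = no λ h → ¬h (λ t → h (zeroE t))
... | yes _  | no ¬h  = no λ h → ¬h (λ s → h (letter s))

isColPPartition? : ∀ {r n} .{{_ : NonZero r}} (π : ColPerm r n) (j : ℕ)
                   (f : Elem r n → Cod r j) → Dec (IsColPPartition π j f)
isColPPartition? {r} π j f
  with FinP.all? (λ t → ≡-dec _≟_ _≟_ (toP (f (zeroE t))) (suc (toℕ t) , 0))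
     | allElem? (λ a → allElem? (λ b → (a ≺? b) →-dec (toP (f a) ≤ℓ? toP (f b))))
     | allElem? (λ a → allElem? (λ b → (a ≺? b) →-dec
         (FinP._≟_ (proj₁ (f a)) (proj₁ (f b)) →-dec
           ((shiftBy r (lab π b) (toℕ (proj₁ (f a)))
              <ℓ? shiftBy r (lab π a) (toℕ (proj₁ (f a)))) →-dec
             (toP (f a) <ℓ? toP (f b))))))
     | allElem? (λ a → (toℕ (proj₂ (f a)) ≟ j) →-dec (proj₁ (lab π a) ≟ toℕ (proj₁ (f a))))
... | yes h1 | yes h2 | yes h3 | yes h4 = yes (record { cond-i = h1 ; cond-ii = h2 ; cond-iii = h3 ; cond-iv = h4 })
... | no ¬h  | _      | _      | _      = no λ p → ¬h (IsColPPartition.cond-i p)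
... | yes _  | no ¬h  | _      | _      = no λ p → ¬h (IsColPPartition.cond-ii p)
... | yes _  | yes _  | no ¬h  | _      = no λ p → ¬h (IsColPPartition.cond-iii p)
... | yes _  | yes _  | yes _  | no ¬h  = no λ p → ¬h (IsColPPartition.cond-iv p)

allFns : ∀ {A : Set} (m : ℕ) → List A → List (Vector A m)
allFns zero    xs = (λ ()) ∷ []
allFns (suc m) xs = concatMap (λ x → map (x VF.∷_) (allFns m xs)) xs

allCod : (r j : ℕ) → List (Cod r j)
allCod r j = cartesianProduct (allFin r) (allFin (suc j))

toMap : ∀ {r n} {A : Set} → Vector A (r ∸ 1) → Vector A n → Elem r n → A
toMap g h (zeroE t)  = g t
toMap g h (letter s) = h s

allMaps : (r n j : ℕ) → List (Elem r n → Cod r j)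
allMaps r n j = map (λ gh → toMap (proj₁ gh) (proj₂ gh))
                    (cartesianProduct (allFns (r ∸ 1) (allCod r j)) (allFns n (allCod r j)))

Ω : ∀ {r n} .{{_ : NonZero r}} → ColPerm r n → ℕ → ℕ
Ω {r} {n} π j = length (filter (isColPPartition? π j) (allMaps r n j))

module Submission where

open import Defs
open import Data.Nat using (ℕ; zero; suc; pred; _+_; _*_; _∸_; _<_; _≤_; _<?_; _≟_; _<ᵇ_; z≤n; s≤s; s≤s⁻¹; NonZero; >-nonZero)
open import Data.Nat.Properties
open import Data.Nat.DivMod using (_%_; [m+n]%n≡m%n; m<n⇒m%n≡m)
open import Data.Nat.Tactic.RingSolver using (solve-∀)
open import Data.Bool using (Bool; true; false; if_then_else_)
open import Data.Fin using (Fin; toℕ; zero; suc; fromℕ; fromℕ<; _↑ˡ_; _↑ʳ_)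
import Data.Fin.Properties as Fin
import Data.Fin.Permutation as Permutation
open import Data.Fin.Permutation using (_⟨$⟩ʳ_)
open import Data.List using (List; []; _∷_; map; concatMap; filter; length; _++_; cartesianProduct; allFin; upTo)
open import Data.List.Membership.Propositional using (_∈_)
open import Data.List.Membership.Propositional.Properties using (∈-map⁻; ∈-cartesianProduct⁻; ∈-cartesianProduct⁺; ∈-allFin; ∈-upTo⁺)
open import Data.List.Relation.Unary.All using (All; []; _∷_)
import Data.List.Relation.Unary.All as All
open import Data.List.Relation.Unary.AllPairs using (AllPairs; []; _∷_)
import Data.List.Relation.Unary.AllPairs as AllPairs
import Data.List.Relation.Unary.AllPairs.Properties as AllPairsₚ
open import Data.List.Relation.Unary.Any using (here; there)
open import Data.Vec.Functional as VF using (Vector)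
open import Data.Product using (_×_; _,_; proj₁; proj₂; ∃; ∃₂)
open import Data.Product.Properties using (≡-dec)
open import Data.Sum using (_⊎_; inj₁; inj₂)
open import Data.Unit using (⊤; tt)
open import Data.Empty using (⊥; ⊥-elim)
open import Function using (_∘_; id)
open import Relation.Nullary using (Dec; yes; no; ¬_)
open import Relation.Nullary.Decidable using (_×-dec_; _⊎-dec_; _→-dec_; ¬?)
open import Relation.Nullary.Reflects using (ofʸ; ofⁿ)
open import Relation.Unary using (Decidable)
open import Relation.Binary.Definitions using (DecidableEquality; tri<; tri≈; tri>)
open import Relation.Binary.PropositionalEquality

-- Ω_{P(π)}(j) is the number of partitions of the chain 0₁ ≺ ⋯ ≺ 0_{r−1}, which does not involve π,
-- times the number of labellings of the letter chain π(1) ≺ ⋯ ≺ π(n) satisfying (ii)–(iv); on a chain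
-- it suffices to check consecutive letters. Cut the letters after the monochromatic head π(1) ⋯ π(i).
-- For a fixed valid labelling of the tail, in which π(i+1) gets the value T, the head labellings are
-- the chains (weak, strict at the descents of |π(1)| ⋯ |π(i)|) in the set of values admissible below T,
-- so their number depends only on the size of that set. Recolouring the head from a = ε(π(1)) to
-- b = ε(π(i+1)) changes this size only through the two candidates (a , j) / (b , j) and T itself, and
-- a case analysis of colours, compared as residues modulo r, shows the change vanishes exactly when
-- b < a ⇔ |π(i+1)| < |π(i)|. That is what des π = des ρ(π) says, all other descents being equal.

sumBy : ∀ {A : Set} → (A → ℕ) → List A → ℕ
sumBy f []       = 0
sumBy f (x ∷ xs) = f x + sumBy f xs

𝟙 : ∀ {p} {P : Set p} → Dec P → ℕ
𝟙 (yes _) = 1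
𝟙 (no _)  = 0

count : ∀ {A : Set} {P : A → Set} → Decidable P → List A → ℕ
count P? = sumBy (λ x → 𝟙 (P? x))

length-filter≡count : ∀ {A : Set} {P : A → Set} (P? : Decidable P) xs →
                      length (filter P? xs) ≡ count P? xs
length-filter≡count P? []       = refl
length-filter≡count P? (x ∷ xs) with P? x
... | yes _ = cong suc (length-filter≡count P? xs)
... | no _  = length-filter≡count P? xs

module _ {p} {P : Set p} where

  𝟙-yes : (P? : Dec P) → P → 𝟙 P? ≡ 1
  𝟙-yes (yes _) _ = refl
  𝟙-yes (no ¬p) p = ⊥-elim (¬p p)

  𝟙-no : (P? : Dec P) → ¬ P → 𝟙 P? ≡ 0
  𝟙-no (yes p) ¬p = ⊥-elim (¬p p)
  𝟙-no (no _)  _  = refl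

module _ {p q} {P : Set p} {Q : Set q} where

  𝟙-cong : (P? : Dec P) (Q? : Dec Q) → (P → Q) → (Q → P) → 𝟙 P? ≡ 𝟙 Q?
  𝟙-cong (yes _) (yes _) f g = refl
  𝟙-cong (yes p) (no ¬q) f g = ⊥-elim (¬q (f p))
  𝟙-cong (no ¬p) (yes q) f g = ⊥-elim (¬p (g q))
  𝟙-cong (no _)  (no _)  f g = refl

  𝟙-injective : (P? : Dec P) (Q? : Dec Q) → 𝟙 P? ≡ 𝟙 Q? → (P → Q) × (Q → P)
  𝟙-injective (yes p) (yes q) _ = (λ _ → q) , (λ _ → p)
  𝟙-injective (no ¬p) (no ¬q) _ = (λ p → ⊥-elim (¬p p)) , (λ q → ⊥-elim (¬q q))

  𝟙-× : (P? : Dec P) (Q? : Dec Q) → 𝟙 (P? ×-dec Q?) ≡ 𝟙 P? * 𝟙 Q?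
  𝟙-× (yes _) (yes _) = refl
  𝟙-× (yes _) (no _)  = refl
  𝟙-× (no _)  _       = refl

  𝟙-⊎ : (P? : Dec P) (Q? : Dec Q) → (P → Q → ⊥) → 𝟙 (P? ⊎-dec Q?) ≡ 𝟙 P? + 𝟙 Q?
  𝟙-⊎ (yes p) (yes q) disj = ⊥-elim (disj p q)
  𝟙-⊎ (yes _) (no _)  _    = refl
  𝟙-⊎ (no _)  (yes _) _    = refl
  𝟙-⊎ (no _)  (no _)  _    = refl

module _ {A : Set} where

  sumBy-cong : {f g : A → ℕ} → (∀ x → f x ≡ g x) → ∀ xs → sumBy f xs ≡ sumBy g xs
  sumBy-cong f≗g []       = refl
  sumBy-cong f≗g (x ∷ xs) = cong₂ _+_ (f≗g x) (sumBy-cong f≗g xs)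

  sumBy-cong-All : {f g : A → ℕ} {xs : List A} → All (λ x → f x ≡ g x) xs → sumBy f xs ≡ sumBy g xs
  sumBy-cong-All []         = refl
  sumBy-cong-All (e ∷ es) = cong₂ _+_ e (sumBy-cong-All es)

  sumBy-zero : (xs : List A) → sumBy (λ _ → 0) xs ≡ 0
  sumBy-zero []       = refl
  sumBy-zero (_ ∷ xs) = sumBy-zero xs

  sumBy-++ : (f : A → ℕ) → ∀ xs ys → sumBy f (xs ++ ys) ≡ sumBy f xs + sumBy f ys
  sumBy-++ f []       ys = refl
  sumBy-++ f (x ∷ xs) ys = trans (cong (f x +_) (sumBy-++ f xs ys)) (sym (+-assoc (f x) _ _))

  sumBy-+ : (f g : A → ℕ) → ∀ xs → sumBy (λ x → f x + g x) xs ≡ sumBy f xs + sumBy g xs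
  sumBy-+ f g []       = refl
  sumBy-+ f g (x ∷ xs) = trans (cong (f x + g x +_) (sumBy-+ f g xs)) (+-interchange (f x) _ _ _)
    where
    +-interchange : ∀ a b c d → a + b + (c + d) ≡ a + c + (b + d)
    +-interchange = solve-∀

  sumBy-*ˡ : (c : ℕ) (f : A → ℕ) → ∀ xs → sumBy (λ x → c * f x) xs ≡ c * sumBy f xs
  sumBy-*ˡ c f []       = sym (*-zeroʳ c)
  sumBy-*ˡ c f (x ∷ xs) = trans (cong (c * f x +_) (sumBy-*ˡ c f xs)) (sym (*-distribˡ-+ c (f x) _))

sumBy-map : ∀ {A B : Set} (f : B → ℕ) (g : A → B) → ∀ xs → sumBy f (map g xs) ≡ sumBy (λ x → f (g x)) xs
sumBy-map f g []       = refl
sumBy-map f g (x ∷ xs) = cong (f (g x) +_) (sumBy-map f g xs)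

module _ {A B : Set} where

  sumBy-concatMap : (f : B → ℕ) (g : A → List B) → ∀ xs →
                    sumBy f (concatMap g xs) ≡ sumBy (λ x → sumBy f (g x)) xs
  sumBy-concatMap f g []       = refl
  sumBy-concatMap f g (x ∷ xs) =
    trans (sumBy-++ f (g x) (concatMap g xs)) (cong (sumBy f (g x) +_) (sumBy-concatMap f g xs))

  sumBy-swap : (f : A → B → ℕ) → ∀ xs ys →
               sumBy (λ x → sumBy (f x) ys) xs ≡ sumBy (λ y → sumBy (λ x → f x y) xs) ys
  sumBy-swap f []       ys = sym (sumBy-zero ys)
  sumBy-swap f (x ∷ xs) ys =
    trans (cong (sumBy (f x) ys +_) (sumBy-swap f xs ys)) (sym (sumBy-+ (f x) _ ys))

  sumBy-cartesianProduct : (f : A × B → ℕ) → ∀ xs ys →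
    sumBy f (cartesianProduct xs ys) ≡ sumBy (λ x → sumBy (λ y → f (x , y)) ys) xs
  sumBy-cartesianProduct f []       ys = refl
  sumBy-cartesianProduct f (x ∷ xs) ys =
    trans (sumBy-++ f (map (x ,_) ys) (cartesianProduct xs ys))
          (cong₂ _+_ (sumBy-map f (x ,_) ys) (sumBy-cartesianProduct f xs ys))

module _ {A : Set} {P Q : A → Set} (P? : Decidable P) (Q? : Decidable Q) where

  count-cong : (∀ x → P x → Q x) → (∀ x → Q x → P x) → ∀ xs → count P? xs ≡ count Q? xs
  count-cong f g = sumBy-cong (λ x → 𝟙-cong (P? x) (Q? x) (f x) (g x))

  count-⊎ : (∀ x → P x → Q x → ⊥) → ∀ xs →
            count (λ x → P? x ⊎-dec Q? x) xs ≡ count P? xs + count Q? xs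
  count-⊎ disj xs = trans (sumBy-cong (λ x → 𝟙-⊎ (P? x) (Q? x) (disj x)) xs) (sumBy-+ _ _ xs)

count-const× : ∀ {A : Set} {P : Set} {Q : A → Set} (P? : Dec P) (Q? : Decidable Q) → ∀ xs →
               count (λ x → P? ×-dec Q? x) xs ≡ 𝟙 P? * count Q? xs
count-const× P? Q? xs = trans (sumBy-cong (λ x → 𝟙-× P? (Q? x)) xs) (sumBy-*ˡ (𝟙 P?) _ xs)

-- Defined by recursion on the first vector, so that (x ∷ h) ⧺ t reduces to x ∷ (h ⧺ t);
-- Data.Vec.Functional._++_ does not.
_⧺_ : ∀ {A : Set} {K N} → Vector A K → Vector A N → Vector A (K + N)
_⧺_ {K = zero}  h t = t
_⧺_ {K = suc K} h t = VF.head h VF.∷ (VF.tail h ⧺ t)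

⧺-split : ∀ {A : Set} K {N} (w : Vector A (K + N)) i → w i ≡ ((λ i → w (i ↑ˡ N)) ⧺ (λ i → w (K ↑ʳ i))) i
⧺-split zero    w i       = refl
⧺-split (suc K) w zero    = refl
⧺-split (suc K) w (suc i) = ⧺-split K (w ∘ suc) i

⧺-cong : ∀ {A : Set} K {N} {h h′ : Vector A K} {t t′ : Vector A N} →
         (∀ i → h i ≡ h′ i) → (∀ i → t i ≡ t′ i) → ∀ i → (h ⧺ t) i ≡ (h′ ⧺ t′) i
⧺-cong zero    h≗h′ t≗t′ i       = t≗t′ i
⧺-cong (suc K) h≗h′ t≗t′ zero    = h≗h′ zero
⧺-cong (suc K) h≗h′ t≗t′ (suc i) = ⧺-cong K (h≗h′ ∘ suc) t≗t′ i

last : ∀ {A : Set} {K} → Vector A (suc K) → A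
last {K = zero}  v = v zero
last {K = suc K} v = last (VF.tail v)

last-∀ : ∀ {A : Set} {P : A → Set} {K} (v : Vector A (suc K)) → (∀ i → P (v i)) → P (last v)
last-∀ {K = zero}  v all = all zero
last-∀ {P = P} {K = suc K} v all = last-∀ {P = P} (VF.tail v) (all ∘ suc)

last≡fromℕ : ∀ {A : Set} K (v : Vector A (suc K)) → last v ≡ v (fromℕ K)
last≡fromℕ zero    v = refl
last≡fromℕ (suc K) v = last≡fromℕ K (VF.tail v)

count-allFns-⧺ : ∀ {A : Set} (xs : List A) → ∀ K N {P : Vector A (K + N) → Set} (P? : Decidable P) →
  count P? (allFns (K + N) xs) ≡ sumBy (λ h → count (λ t → P? (h ⧺ t)) (allFns N xs)) (allFns K xs)
count-allFns-⧺ xs zero    N P? = sym (+-identityʳ _)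
count-allFns-⧺ xs (suc K) N P? = begin
  count P? (allFns (suc K + N) xs)
    ≡⟨ sumBy-concatMap _ (λ x → map (x VF.∷_) (allFns (K + N) xs)) xs ⟩
  sumBy (λ x → sumBy (λ v → 𝟙 (P? v)) (map (x VF.∷_) (allFns (K + N) xs))) xs
    ≡⟨ sumBy-cong (λ x → trans (sumBy-map _ (x VF.∷_) (allFns (K + N) xs))
                               (count-allFns-⧺ xs K N (λ v → P? (x VF.∷ v)))) xs ⟩
  sumBy (λ x → sumBy (λ h → count (λ t → P? (x VF.∷ (h ⧺ t))) (allFns N xs)) (allFns K xs)) xs
    ≡⟨ sumBy-cong (λ x → sym (sumBy-map _ (x VF.∷_) (allFns K xs))) xs ⟩
  sumBy (λ x → sumBy (λ h → count (λ t → P? (h ⧺ t)) (allFns N xs)) (map (x VF.∷_) (allFns K xs))) xs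
    ≡⟨ sym (sumBy-concatMap _ (λ x → map (x VF.∷_) (allFns K xs)) xs) ⟩
  sumBy (λ h → count (λ t → P? (h ⧺ t)) (allFns N xs)) (allFns (suc K) xs) ∎
  where open ≡-Reasoning

module _ {P Q : ℕ → Set} (P? : Decidable P) (Q? : Decidable Q) (m₀ : ℕ)
         (P⇒Q : ∀ m → m ≢ m₀ → P m → Q m) (Q⇒P : ∀ m → m ≢ m₀ → Q m → P m) where

  private
    occurrences : List ℕ → ℕ
    occurrences = count (_≟ m₀)

    balance : ∀ ms → count P? ms + occurrences ms * 𝟙 (Q? m₀) ≡ count Q? ms + occurrences ms * 𝟙 (P? m₀)
    balance []       = refl
    balance (m ∷ ms) with m ≟ m₀
    ... | yes refl = trans (shuffle (𝟙 (P? m)) (𝟙 (Q? m)) (count P? ms) (occurrences ms))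
                     (trans (cong (𝟙 (P? m) + 𝟙 (Q? m) +_) (balance ms))
                            (sym (shuffle′ (𝟙 (P? m)) (𝟙 (Q? m)) (count Q? ms) (occurrences ms))))
      where
      shuffle : ∀ p q c o → p + c + suc o * q ≡ p + q + (c + o * q)
      shuffle = solve-∀
      shuffle′ : ∀ p q c o → q + c + suc o * p ≡ p + q + (c + o * p)
      shuffle′ = solve-∀
    ... | no m≢m₀ = trans (cong (λ z → z + count P? ms + _) (𝟙-cong (P? m) (Q? m) (P⇒Q m m≢m₀) (Q⇒P m m≢m₀)))
                    (trans (+-assoc (𝟙 (Q? m)) _ _)
                    (trans (cong (𝟙 (Q? m) +_) (balance ms)) (sym (+-assoc (𝟙 (Q? m)) _ _))))

    occurrences-pos : ∀ ms → m₀ ∈ ms → ∃ λ o → occurrences ms ≡ suc o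
    occurrences-pos (m ∷ ms) (here refl) with m₀ ≟ m₀
    ... | yes _   = occurrences ms , refl
    ... | no ¬eq = ⊥-elim (¬eq refl)
    occurrences-pos (m ∷ ms) (there m₀∈ms) with m ≟ m₀ | occurrences-pos ms m₀∈ms
    ... | yes _ | o , eq = suc o , cong suc eq
    ... | no _  | o , eq = o , eq

  count-≡⇒⇔-at : ∀ ms → count P? ms ≡ count Q? ms → m₀ ∈ ms → (P m₀ → Q m₀) × (Q m₀ → P m₀)
  count-≡⇒⇔-at ms eq m₀∈ms with occurrences-pos ms m₀∈ms
  ... | o , occ≡ = 𝟙-injective (P? m₀) (Q? m₀) (sym (*-cancelˡ-≡ _ _ (suc o) scaled))
    where
    scaled : suc o * 𝟙 (Q? m₀) ≡ suc o * 𝟙 (P? m₀)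
    scaled = subst (λ z → z * 𝟙 (Q? m₀) ≡ z * 𝟙 (P? m₀)) occ≡
               (+-cancelˡ-≡ (count P? ms) _ _ (trans (balance ms) (cong (_+ _) (sym eq))))

<ℓ-trans : ∀ {p q s} → p <ℓ q → q <ℓ s → p <ℓ s
<ℓ-trans (inj₁ k<l)         (inj₁ l<m)         = inj₁ (<-trans k<l l<m)
<ℓ-trans (inj₁ k<l)         (inj₂ (refl , _))  = inj₁ k<l
<ℓ-trans (inj₂ (refl , _))  (inj₁ l<m)         = inj₁ l<m
<ℓ-trans (inj₂ (refl , x<y)) (inj₂ (refl , y<z)) = inj₂ (refl , <-trans x<y y<z)

<ℓ-irrefl : ∀ {p} → ¬ (p <ℓ p)
<ℓ-irrefl (inj₁ k<k)       = <-irrefl refl k<k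
<ℓ-irrefl (inj₂ (_ , x<x)) = <-irrefl refl x<x

<ℓ-asym : ∀ {p q} → p <ℓ q → ¬ (q <ℓ p)
<ℓ-asym p<q q<p = <ℓ-irrefl (<ℓ-trans p<q q<p)

<ℓ-trichotomy : ∀ p q → p <ℓ q ⊎ p ≡ q ⊎ q <ℓ p
<ℓ-trichotomy (k , x) (l , y) with <-cmp k l
... | tri< k<l _ _ = inj₁ (inj₁ k<l)
... | tri> _ _ l<k = inj₂ (inj₂ (inj₁ l<k))
... | tri≈ _ refl _ with <-cmp x y
...   | tri< x<y _ _  = inj₁ (inj₂ (refl , x<y))
...   | tri≈ _ refl _ = inj₂ (inj₁ refl)
...   | tri> _ _ y<x  = inj₂ (inj₂ (inj₂ (refl , y<x)))

<ℓ-sameColour : ∀ {e x y} → (e , x) <ℓ (e , y) → x < y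
<ℓ-sameColour (inj₁ e<e)       = ⊥-elim (<-irrefl refl e<e)
<ℓ-sameColour (inj₂ (_ , x<y)) = x<y

≤ℓ-trans : ∀ {p q s} → p ≤ℓ q → q ≤ℓ s → p ≤ℓ s
≤ℓ-trans (inj₁ p<q) (inj₁ q<s) = inj₁ (<ℓ-trans p<q q<s)
≤ℓ-trans (inj₁ p<q) (inj₂ refl) = inj₁ p<q
≤ℓ-trans (inj₂ refl) q≤s        = q≤s

<-≤ℓ-trans : ∀ {p q s} → p <ℓ q → q ≤ℓ s → p <ℓ s
<-≤ℓ-trans p<q (inj₁ q<s)  = <ℓ-trans p<q q<s
<-≤ℓ-trans p<q (inj₂ refl) = p<q

≤-<ℓ-trans : ∀ {p q s} → p ≤ℓ q → q <ℓ s → p <ℓ s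
≤-<ℓ-trans (inj₁ p<q)  q<s = <ℓ-trans p<q q<s
≤-<ℓ-trans (inj₂ refl) q<s = q<s

≤ℓ⇒≯ℓ : ∀ {p q} → p ≤ℓ q → ¬ (q <ℓ p)
≤ℓ⇒≯ℓ (inj₁ p<q)  = <ℓ-asym p<q
≤ℓ⇒≯ℓ (inj₂ refl) = <ℓ-irrefl

≮ℓ⇒≥ℓ : ∀ {p q} → ¬ (p <ℓ q) → q ≤ℓ p
≮ℓ⇒≥ℓ {p} {q} p≮q with <ℓ-trichotomy p q
... | inj₁ p<q        = ⊥-elim (p≮q p<q)
... | inj₂ (inj₁ p≡q) = inj₂ (sym p≡q)
... | inj₂ (inj₂ q<p) = inj₁ q<p

toP-injective : ∀ {r j} {e e′ : Cod r j} → toP e ≡ toP e′ → e ≡ e′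
toP-injective eq = cong₂ _,_ (Fin.toℕ-injective (cong proj₁ eq)) (Fin.toℕ-injective (cong proj₂ eq))

module Chains (r j : ℕ) where

  _<ᶜ_ _≤ᶜ_ : Cod r j → Cod r j → Set
  e <ᶜ e′ = toP e <ℓ toP e′
  e ≤ᶜ e′ = toP e ≤ℓ toP e′

  _<ᶜ?_ : (e e′ : Cod r j) → Dec (e <ᶜ e′)
  e <ᶜ? e′ = toP e <ℓ? toP e′

  _≤ᶜ?_ : (e e′ : Cod r j) → Dec (e ≤ᶜ e′)
  e ≤ᶜ? e′ = toP e ≤ℓ? toP e′

  allCod-sorted : AllPairs _<ᶜ_ (allCod r j)
  allCod-sorted = product-sorted (allFin r) (allFin (suc j)) (increasing r) (increasing (suc j))
    where
    _<ᶠ_ : ∀ {n} → Fin n → Fin n → Set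
    a <ᶠ b = toℕ a < toℕ b

    increasing : ∀ n → AllPairs _<ᶠ_ (allFin n)
    increasing n = AllPairsₚ.tabulate⁺-< (λ a<b → a<b)

    product-sorted : ∀ xs ys → AllPairs _<ᶠ_ xs → AllPairs _<ᶠ_ ys → AllPairs _<ᶜ_ (cartesianProduct xs ys)
    product-sorted []       ys _          _    = []
    product-sorted (x ∷ xs) ys (x< ∷ xs<) ys< =
      AllPairsₚ.++⁺ (AllPairsₚ.map⁺ (AllPairs.map (λ lt → inj₂ (refl , lt)) ys<)) (product-sorted xs ys xs< ys<)
        (All.tabulate λ a∈ → All.tabulate λ b∈ → across a∈ b∈)
      where
      across : ∀ {a b} → a ∈ map (x ,_) ys → b ∈ cartesianProduct xs ys → a <ᶜ b
      across a∈ b∈ with ∈-map⁻ (x ,_) a∈ | ∈-cartesianProduct⁻ xs ys b∈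
      ... | _ , _ , refl | x′∈xs , _ = inj₁ (All.lookup x< x′∈xs)

  Step : Bool → Cod r j → Cod r j → Set
  Step true  e e′ = e <ᶜ e′
  Step false e e′ = e ≤ᶜ e′

  Step? : ∀ strict e e′ → Dec (Step strict e e′)
  Step? true  = _<ᶜ?_
  Step? false = _≤ᶜ?_

  Step⇒≤ᶜ : ∀ strict {e e′} → Step strict e e′ → e ≤ᶜ e′
  Step⇒≤ᶜ true  e<e′ = inj₁ e<e′
  Step⇒≤ᶜ false e≤e′ = e≤e′

  Step-≤ᶜ-trans : ∀ strict {e e′ e″} → Step strict e e′ → e′ ≤ᶜ e″ → Step strict e e″
  Step-≤ᶜ-trans true  = <-≤ℓ-trans
  Step-≤ᶜ-trans false = ≤ℓ-trans

  isDescent : ∀ {K} → Vector ℕ (suc (suc K)) → Bool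
  isDescent xs = xs (suc zero) <ᵇ xs zero

  -- Condition (iii) between letters of equal colour: a step is strict exactly where xs descends.
  Chain : ∀ {K} → Vector ℕ K → Vector (Cod r j) K → Set
  Chain {zero}        _  _ = ⊤
  Chain {suc zero}    _  _ = ⊤
  Chain {suc (suc K)} xs h = Step (isDescent xs) (h zero) (h (suc zero)) × Chain (VF.tail xs) (VF.tail h)

  Chain? : ∀ {K} (xs : Vector ℕ K) (h : Vector (Cod r j) K) → Dec (Chain xs h)
  Chain? {zero}        _  _ = yes tt
  Chain? {suc zero}    _  _ = yes tt
  Chain? {suc (suc K)} xs h = Step? _ _ _ ×-dec Chain? (VF.tail xs) (VF.tail h)

  Chain⇒head≤ᶜ : ∀ {K} (xs : Vector ℕ (suc K)) h → Chain xs h → ∀ i → h zero ≤ᶜ h i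
  Chain⇒head≤ᶜ {K}     xs h _ zero = inj₂ refl
  Chain⇒head≤ᶜ {suc K} xs h (step , chain) (suc i) =
    ≤ℓ-trans (Step⇒≤ᶜ _ step) (Chain⇒head≤ᶜ (VF.tail xs) (VF.tail h) chain i)

  Chain⇒≤ᶜlast : ∀ {K} (xs : Vector ℕ (suc K)) h → Chain xs h → ∀ i → h i ≤ᶜ last h
  Chain⇒≤ᶜlast {zero}  xs h _ zero = inj₂ refl
  Chain⇒≤ᶜlast {suc K} xs h (step , chain) zero =
    ≤ℓ-trans (Step⇒≤ᶜ _ step) (Chain⇒≤ᶜlast (VF.tail xs) (VF.tail h) chain zero)
  Chain⇒≤ᶜlast {suc K} xs h (_ , chain) (suc i) = Chain⇒≤ᶜlast (VF.tail xs) (VF.tail h) chain i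

  ChainIn : ∀ {K} → Vector ℕ K → (Cod r j → Set) → Vector (Cod r j) K → Set
  ChainIn xs U h = Chain xs h × (∀ i → U (h i))

  ChainIn? : ∀ {K} (xs : Vector ℕ K) {U : Cod r j → Set} → Decidable U → Decidable (ChainIn xs U)
  ChainIn? xs U? h = Chain? xs h ×-dec Fin.all? (λ i → U? (h i))

  sumBelow : ℕ → (ℕ → ℕ) → ℕ
  sumBelow zero    g = 0
  sumBelow (suc m) g = sumBelow m g + g m

  -- The number of chains of shape xs with values in an m-element chain.
  chainCount : ∀ K → Vector ℕ K → ℕ → ℕ
  chainCount zero          _  m = 1
  chainCount (suc zero)    _  m = m
  chainCount (suc (suc K)) xs m =
    sumBelow m (λ i → chainCount (suc K) (VF.tail xs) (if isDescent xs then i else suc i))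

  private
    sumBelow-step : ∀ {p} {P : Set p} (P? : Dec P) (g : ℕ → ℕ) c →
                    𝟙 P? * g c + sumBelow c g ≡ sumBelow (𝟙 P? + c) g
    sumBelow-step (yes _) g c = trans (cong (_+ sumBelow c g) (+-identityʳ (g c))) (+-comm (g c) _)
    sumBelow-step (no _)  g c = refl

    module _ {U : Cod r j → Set} (U? : Decidable U) (g : ℕ → ℕ) where

      sumBy-above : ∀ L → AllPairs _<ᶜ_ L →
        sumBy (λ x → 𝟙 (U? x) * g (count (λ e → U? e ×-dec (x <ᶜ? e)) L)) L ≡ sumBelow (count U? L) g
      sumBy-above []       _            = refl
      sumBy-above (y ∷ L) (y< ∷ L-sorted) = begin
        𝟙 (U? y) * g (𝟙 (U? y ×-dec (y <ᶜ? y)) + count (λ e → U? e ×-dec (y <ᶜ? e)) L)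
          + sumBy (λ x → 𝟙 (U? x) * g (𝟙 (U? y ×-dec (x <ᶜ? y)) + count (λ e → U? e ×-dec (x <ᶜ? e)) L)) L
          ≡⟨ cong₂ (λ a b → 𝟙 (U? y) * g a + b) above-y (sumBy-cong-All (All.map below-y y<)) ⟩
        𝟙 (U? y) * g (count U? L) + sumBy (λ x → 𝟙 (U? x) * g (count (λ e → U? e ×-dec (x <ᶜ? e)) L)) L
          ≡⟨ cong (𝟙 (U? y) * g (count U? L) +_) (sumBy-above L L-sorted) ⟩
        𝟙 (U? y) * g (count U? L) + sumBelow (count U? L) g
          ≡⟨ sumBelow-step (U? y) g (count U? L) ⟩
        sumBelow (count U? (y ∷ L)) g ∎
        where
        open ≡-Reasoning
        above-y : 𝟙 (U? y ×-dec (y <ᶜ? y)) + count (λ e → U? e ×-dec (y <ᶜ? e)) L ≡ count U? L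
        above-y = cong₂ _+_ (𝟙-no (U? y ×-dec (y <ᶜ? y)) (λ z → <ℓ-irrefl (proj₂ z)))
                            (sumBy-cong-All (All.map (λ {e} y<e → 𝟙-cong (U? e ×-dec (y <ᶜ? e)) (U? e) proj₁ (_, y<e)) y<))
        below-y : ∀ {x} → y <ᶜ x →
                  𝟙 (U? x) * g (𝟙 (U? y ×-dec (x <ᶜ? y)) + count (λ e → U? e ×-dec (x <ᶜ? e)) L)
                    ≡ 𝟙 (U? x) * g (count (λ e → U? e ×-dec (x <ᶜ? e)) L)
        below-y {x} y<x = cong (λ a → 𝟙 (U? x) * g (a + count (λ e → U? e ×-dec (x <ᶜ? e)) L))
                               (𝟙-no (U? y ×-dec (x <ᶜ? y)) (λ z → <ℓ-asym y<x (proj₂ z)))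

      sumBy-atLeast : ∀ L → AllPairs _<ᶜ_ L →
        sumBy (λ x → 𝟙 (U? x) * g (count (λ e → U? e ×-dec (x ≤ᶜ? e)) L)) L ≡ sumBelow (count U? L) (g ∘ suc)
      sumBy-atLeast []       _            = refl
      sumBy-atLeast (y ∷ L) (y< ∷ L-sorted) = begin
        𝟙 (U? y) * g (𝟙 (U? y ×-dec (y ≤ᶜ? y)) + count (λ e → U? e ×-dec (y ≤ᶜ? e)) L)
          + sumBy (λ x → 𝟙 (U? x) * g (𝟙 (U? y ×-dec (x ≤ᶜ? y)) + count (λ e → U? e ×-dec (x ≤ᶜ? e)) L)) L
          ≡⟨ cong₂ (λ a b → 𝟙 (U? y) * g a + b) atLeast-y (sumBy-cong-All (All.map below-y y<)) ⟩
        𝟙 (U? y) * g (𝟙 (U? y) + count U? L) + sumBy (λ x → 𝟙 (U? x) * g (count (λ e → U? e ×-dec (x ≤ᶜ? e)) L)) L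
          ≡⟨ cong₂ _+_ (𝟙-*-shift (U? y)) (sumBy-atLeast L L-sorted) ⟩
        𝟙 (U? y) * g (suc (count U? L)) + sumBelow (count U? L) (g ∘ suc)
          ≡⟨ sumBelow-step (U? y) (g ∘ suc) (count U? L) ⟩
        sumBelow (count U? (y ∷ L)) (g ∘ suc) ∎
        where
        open ≡-Reasoning
        atLeast-y : 𝟙 (U? y ×-dec (y ≤ᶜ? y)) + count (λ e → U? e ×-dec (y ≤ᶜ? e)) L ≡ 𝟙 (U? y) + count U? L
        atLeast-y = cong₂ _+_ (𝟙-cong (U? y ×-dec (y ≤ᶜ? y)) (U? y) proj₁ (_, inj₂ refl))
                              (sumBy-cong-All (All.map (λ {e} y<e →
                                 𝟙-cong (U? e ×-dec (y ≤ᶜ? e)) (U? e) proj₁ (_, inj₁ y<e)) y<))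
        below-y : ∀ {x} → y <ᶜ x →
                  𝟙 (U? x) * g (𝟙 (U? y ×-dec (x ≤ᶜ? y)) + count (λ e → U? e ×-dec (x ≤ᶜ? e)) L)
                    ≡ 𝟙 (U? x) * g (count (λ e → U? e ×-dec (x ≤ᶜ? e)) L)
        below-y {x} y<x = cong (λ a → 𝟙 (U? x) * g (a + count (λ e → U? e ×-dec (x ≤ᶜ? e)) L))
                               (𝟙-no (U? y ×-dec (x ≤ᶜ? y)) (λ z → ≤ℓ⇒≯ℓ (proj₂ z) y<x))
        𝟙-*-shift : ∀ {p} {P : Set p} (P? : Dec P) → 𝟙 P? * g (𝟙 P? + count U? L) ≡ 𝟙 P? * g (suc (count U? L))
        𝟙-*-shift (yes _) = refl
        𝟙-*-shift (no _)  = refl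

  sumBy-Step : ∀ strict {U : Cod r j → Set} (U? : Decidable U) (g : ℕ → ℕ) →
    sumBy (λ x → 𝟙 (U? x) * g (count (λ e → U? e ×-dec Step? strict x e) (allCod r j))) (allCod r j)
      ≡ sumBelow (count U? (allCod r j)) (λ i → g (if strict then i else suc i))
  sumBy-Step true  U? g = sumBy-above U? g (allCod r j) allCod-sorted
  sumBy-Step false U? g = sumBy-atLeast U? g (allCod r j) allCod-sorted

  count-ChainIn : ∀ K (xs : Vector ℕ K) {U : Cod r j → Set} (U? : Decidable U) →
                  count (ChainIn? xs U?) (allFns K (allCod r j)) ≡ chainCount K xs (count U? (allCod r j))
  count-ChainIn zero          xs U? = 𝟙-yes (ChainIn? xs U? (λ ())) (tt , λ ())
  count-ChainIn (suc zero)    xs U? =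
    trans (sumBy-concatMap _ (λ x → map (x VF.∷_) (allFns zero (allCod r j))) (allCod r j))
          (sumBy-cong (λ x → trans (+-identityʳ _)
                        (𝟙-cong (ChainIn? xs U? (x VF.∷ λ ())) (U? x)
                                (λ (_ , u) → u zero) (λ u → tt , λ { zero → u })))
                      (allCod r j))
  count-ChainIn (suc (suc K)) xs {U} U? = begin
    count (ChainIn? xs U?) (allFns (suc (suc K)) C)
      ≡⟨ sumBy-concatMap _ (λ x → map (x VF.∷_) (allFns (suc K) C)) C ⟩
    sumBy (λ x → sumBy (λ h → 𝟙 (ChainIn? xs U? h)) (map (x VF.∷_) (allFns (suc K) C))) C
      ≡⟨ sumBy-cong (λ x → trans (sumBy-map _ (x VF.∷_) (allFns (suc K) C))
                                        (split x (count-ChainIn (suc K) (VF.tail xs) (U∩Step? x)))) C ⟩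
    sumBy (λ x → 𝟙 (U? x) * chainCount (suc K) (VF.tail xs) (count (U∩Step? x) C)) C
      ≡⟨ sumBy-Step (isDescent xs) U? (chainCount (suc K) (VF.tail xs)) ⟩
    chainCount (suc (suc K)) xs (count U? C) ∎
    where
    open ≡-Reasoning
    C : List (Cod r j)
    C = allCod r j
    U∩Step? : ∀ x → Decidable (λ e → U e × Step (isDescent xs) x e)
    U∩Step? x e = U? e ×-dec Step? (isDescent xs) x e

    cons⇒ : ∀ x h → ChainIn xs U (x VF.∷ h) → U x × ChainIn (VF.tail xs) (λ e → U e × Step (isDescent xs) x e) h
    cons⇒ x h ((step , chain) , inU) =
      inU zero , chain , λ i → inU (suc i) , Step-≤ᶜ-trans _ step (Chain⇒head≤ᶜ (VF.tail xs) h chain i)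

    cons⇐ : ∀ x h → U x × ChainIn (VF.tail xs) (λ e → U e × Step (isDescent xs) x e) h → ChainIn xs U (x VF.∷ h)
    cons⇐ x h (ux , chain , inU) = (proj₂ (inU zero) , chain) , λ { zero → ux ; (suc i) → proj₁ (inU i) }

    split : ∀ x → count (ChainIn? (VF.tail xs) (U∩Step? x)) (allFns (suc K) C)
                    ≡ chainCount (suc K) (VF.tail xs) (count (U∩Step? x) C) →
            count (λ h → ChainIn? xs U? (x VF.∷ h)) (allFns (suc K) C)
              ≡ 𝟙 (U? x) * chainCount (suc K) (VF.tail xs) (count (U∩Step? x) C)
    split x tail-count = begin
      count (λ h → ChainIn? xs U? (x VF.∷ h)) (allFns (suc K) C)
        ≡⟨ count-cong _ (λ h → U? x ×-dec ChainIn? (VF.tail xs) (U∩Step? x) h)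
                      (cons⇒ x) (cons⇐ x) (allFns (suc K) C) ⟩
      count (λ h → U? x ×-dec ChainIn? (VF.tail xs) (U∩Step? x) h) (allFns (suc K) C)
        ≡⟨ count-const× (U? x) (ChainIn? (VF.tail xs) (U∩Step? x)) (allFns (suc K) C) ⟩
      𝟙 (U? x) * count (ChainIn? (VF.tail xs) (U∩Step? x)) (allFns (suc K) C)
        ≡⟨ cong (𝟙 (U? x) *_) tail-count ⟩
      𝟙 (U? x) * chainCount (suc K) (VF.tail xs) (count (U∩Step? x) C) ∎

module Valid (r j : ℕ) .{{_ : NonZero r}} where

  open Chains r j

  -- Condition (iv) for a letter of colour c, and conditions (ii)–(iii) for letters labelled w₀ ≺ w₁.
  ColourAtTop : ℕ → Cod r j → Set
  ColourAtTop c e = toℕ (proj₂ e) ≡ j → c ≡ toℕ (proj₁ e)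

  ColourAtTop? : ∀ c e → Dec (ColourAtTop c e)
  ColourAtTop? c e = (toℕ (proj₂ e) ≟ j) →-dec (c ≟ toℕ (proj₁ e))

  Increase : ℕ × ℕ → ℕ × ℕ → Cod r j → Cod r j → Set
  Increase w₀ w₁ e₀ e₁ =
    e₀ ≤ᶜ e₁ ×
    (proj₁ e₀ ≡ proj₁ e₁ → shiftBy r w₁ (toℕ (proj₁ e₀)) <ℓ shiftBy r w₀ (toℕ (proj₁ e₀)) → e₀ <ᶜ e₁)

  Increase? : ∀ w₀ w₁ e₀ e₁ → Dec (Increase w₀ w₁ e₀ e₁)
  Increase? w₀ w₁ e₀ e₁ = (e₀ ≤ᶜ? e₁) ×-dec ((proj₁ e₀ Fin.≟ proj₁ e₁) →-dec
    ((shiftBy r w₁ (toℕ (proj₁ e₀)) <ℓ? shiftBy r w₀ (toℕ (proj₁ e₀))) →-dec (e₀ <ᶜ? e₁)))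

  LocallyValid : ∀ {n} → Vector (ℕ × ℕ) n → Vector (Cod r j) n → Set
  LocallyValid {zero}        w h = ⊤
  LocallyValid {suc zero}    w h = ColourAtTop (proj₁ (w zero)) (h zero)
  LocallyValid {suc (suc n)} w h = ColourAtTop (proj₁ (w zero)) (h zero)
                                 × Increase (w zero) (w (suc zero)) (h zero) (h (suc zero))
                                 × LocallyValid (VF.tail w) (VF.tail h)

  LocallyValid? : ∀ {n} (w : Vector (ℕ × ℕ) n) → Decidable (LocallyValid w)
  LocallyValid? {zero}        w h = yes tt
  LocallyValid? {suc zero}    w h = ColourAtTop? (proj₁ (w zero)) (h zero)
  LocallyValid? {suc (suc n)} w h = ColourAtTop? (proj₁ (w zero)) (h zero)
    ×-dec (Increase? (w zero) (w (suc zero)) (h zero) (h (suc zero)) ×-dec LocallyValid? (VF.tail w) (VF.tail h))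

  LocallyValid-resp : ∀ {n} {w w′ : Vector (ℕ × ℕ) n} → (∀ i → w i ≡ w′ i) →
                      ∀ h → LocallyValid w h → LocallyValid w′ h
  LocallyValid-resp {zero}        w≗w′ h _ = tt
  LocallyValid-resp {suc zero}    w≗w′ h v = subst (λ x → ColourAtTop (proj₁ x) (h zero)) (w≗w′ zero) v
  LocallyValid-resp {suc (suc n)} w≗w′ h (top , inc , rest) =
    subst (λ x → ColourAtTop (proj₁ x) (h zero)) (w≗w′ zero) top ,
    subst₂ (λ x y → Increase x y (h zero) (h (suc zero))) (w≗w′ zero) (w≗w′ (suc zero)) inc ,
    LocallyValid-resp (w≗w′ ∘ suc) (VF.tail h) rest

  LocallyValid⇒ColourAtTop₀ : ∀ {n} (w : Vector (ℕ × ℕ) (suc n)) h →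
                              LocallyValid w h → ColourAtTop (proj₁ (w zero)) (h zero)
  LocallyValid⇒ColourAtTop₀ {zero}  w h v = v
  LocallyValid⇒ColourAtTop₀ {suc n} w h v = proj₁ v

  LocallyValid-⧺⁻ : ∀ K {N} (wH : Vector (ℕ × ℕ) (suc K)) (wT : Vector (ℕ × ℕ) (suc N)) h t →
    LocallyValid (wH ⧺ wT) (h ⧺ t) →
    LocallyValid wH h × Increase (last wH) (wT zero) (last h) (t zero) × LocallyValid wT t
  LocallyValid-⧺⁻ zero    wH wT h t v = v
  LocallyValid-⧺⁻ (suc K) wH wT h t (top , inc , rest) with LocallyValid-⧺⁻ K (VF.tail wH) wT (VF.tail h) t rest
  ... | vH , boundary , vT = (top , inc , vH) , boundary , vT

  LocallyValid-⧺⁺ : ∀ K {N} (wH : Vector (ℕ × ℕ) (suc K)) (wT : Vector (ℕ × ℕ) (suc N)) h t →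
    LocallyValid wH h × Increase (last wH) (wT zero) (last h) (t zero) × LocallyValid wT t →
    LocallyValid (wH ⧺ wT) (h ⧺ t)
  LocallyValid-⧺⁺ zero    wH wT h t v = v
  LocallyValid-⧺⁺ (suc K) wH wT h t ((top , inc , vH) , boundary , vT) =
    top , inc , LocallyValid-⧺⁺ K (VF.tail wH) wT (VF.tail h) t (vH , boundary , vT)

  Increase⇔Step : ∀ c x₀ x₁ e₀ e₁ → (Increase (c , x₀) (c , x₁) e₀ e₁ → Step (x₁ <ᵇ x₀) e₀ e₁)
                                    × (Step (x₁ <ᵇ x₀) e₀ e₁ → Increase (c , x₀) (c , x₁) e₀ e₁)
  Increase⇔Step c x₀ x₁ e₀ e₁ with x₁ <ᵇ x₀ | <ᵇ-reflects-< x₁ x₀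
  ... | false | ofⁿ x₁≮x₀ = proj₁ , λ e₀≤e₁ → e₀≤e₁ , λ _ shifted → ⊥-elim (x₁≮x₀ (<ℓ-sameColour shifted))
  ... | true  | ofʸ x₁<x₀ = strict , λ e₀<e₁ → inj₁ e₀<e₁ , λ _ _ → e₀<e₁
    where
    strict : Increase (c , x₀) (c , x₁) e₀ e₁ → e₀ <ᶜ e₁
    strict (inj₁ e₀<e₁ , _) = e₀<e₁
    strict (inj₂ eq , forced) with toP-injective {e = e₀} {e₁} eq
    ... | refl = forced refl (inj₂ (refl , x₁<x₀))

  headLabels : ℕ → ∀ {K} → Vector ℕ K → Vector (ℕ × ℕ) K
  headLabels c xs i = c , xs i

  last-headLabels : ∀ c {K} (xs : Vector ℕ (suc K)) → last (headLabels c xs) ≡ (c , last xs)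
  last-headLabels c {zero}  xs = refl
  last-headLabels c {suc K} xs = last-headLabels c (VF.tail xs)

  LocallyValid-head⁻ : ∀ c {K} (xs : Vector ℕ (suc K)) h →
    LocallyValid (headLabels c xs) h → (∀ i → ColourAtTop c (h i)) × Chain xs h
  LocallyValid-head⁻ c {zero}  xs h top = (λ { zero → top }) , tt
  LocallyValid-head⁻ c {suc K} xs h (top , inc , rest) with LocallyValid-head⁻ c (VF.tail xs) (VF.tail h) rest
  ... | tops , chain = (λ { zero → top ; (suc i) → tops i }) , proj₁ (Increase⇔Step c _ _ _ _) inc , chain

  LocallyValid-head⁺ : ∀ c {K} (xs : Vector ℕ (suc K)) h →
    (∀ i → ColourAtTop c (h i)) → Chain xs h → LocallyValid (headLabels c xs) h
  LocallyValid-head⁺ c {zero}  xs h tops _ = tops zero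
  LocallyValid-head⁺ c {suc K} xs h tops (step , chain) =
    tops zero , proj₂ (Increase⇔Step c _ _ _ _) step , LocallyValid-head⁺ c (VF.tail xs) (VF.tail h) (tops ∘ suc) chain

  BoundaryOK : ℕ × ℕ → ℕ × ℕ → Cod r j → Set
  BoundaryOK w₀ w₁ T = ¬ (shiftBy r w₁ (toℕ (proj₁ T)) <ℓ shiftBy r w₀ (toℕ (proj₁ T)))

  BoundaryOK? : ∀ w₀ w₁ T → Dec (BoundaryOK w₀ w₁ T)
  BoundaryOK? w₀ w₁ T = ¬? (shiftBy r w₁ (toℕ (proj₁ T)) <ℓ? shiftBy r w₀ (toℕ (proj₁ T)))

  MayPrecede : ℕ × ℕ → ℕ × ℕ → Cod r j → Cod r j → Set
  MayPrecede w₀ w₁ T e = e <ᶜ T ⊎ (e ≡ T × BoundaryOK w₀ w₁ T)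

  Increase⇒MayPrecede : ∀ w₀ w₁ e T → Increase w₀ w₁ e T → MayPrecede w₀ w₁ T e
  Increase⇒MayPrecede w₀ w₁ e T (inj₁ e<T , _)    = inj₁ e<T
  Increase⇒MayPrecede w₀ w₁ e T (inj₂ eq , forced) with toP-injective {e = e} {T} eq
  ... | refl = inj₂ (refl , λ shifted → <ℓ-irrefl (forced refl shifted))

  MayPrecede⇒Increase : ∀ w₀ w₁ e T → MayPrecede w₀ w₁ T e → Increase w₀ w₁ e T
  MayPrecede⇒Increase w₀ w₁ e T (inj₁ e<T)         = inj₁ e<T , λ _ _ → e<T
  MayPrecede⇒Increase w₀ w₁ e T (inj₂ (refl , ok)) = inj₂ refl , λ _ shifted → ⊥-elim (ok shifted)

  MayPrecede-≤ᶜ : ∀ w₀ w₁ T {e e′} → e ≤ᶜ e′ → MayPrecede w₀ w₁ T e′ → MayPrecede w₀ w₁ T e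
  MayPrecede-≤ᶜ w₀ w₁ T e≤e′ (inj₁ e′<T) = inj₁ (≤-<ℓ-trans e≤e′ e′<T)
  MayPrecede-≤ᶜ w₀ w₁ T (inj₁ e<T) (inj₂ (refl , _)) = inj₁ e<T
  MayPrecede-≤ᶜ w₀ w₁ T {e} (inj₂ eq) (inj₂ (refl , ok)) with toP-injective {e = e} {T} eq
  ... | refl = inj₂ (refl , ok)

  -- The values allowed to the last head letter, labelled (c , x), when the first tail letter,
  -- labelled w₁, takes the value T.
  Admissible : ℕ → ℕ → ℕ × ℕ → Cod r j → Cod r j → Set
  Admissible c x w₁ T e = ColourAtTop c e × MayPrecede (c , x) w₁ T e

  Admissible? : ∀ c x w₁ T → Decidable (Admissible c x w₁ T)
  Admissible? c x w₁ T e =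
    ColourAtTop? c e ×-dec ((e <ᶜ? T) ⊎-dec (≡-dec Fin._≟_ Fin._≟_ e T ×-dec BoundaryOK? (c , x) w₁ T))

  module _ (c : ℕ) {K′ N′} (xs : Vector ℕ (suc K′)) (wT : Vector (ℕ × ℕ) (suc N′)) where

    private
      Admissibleᵗ : Vector (Cod r j) (suc N′) → Cod r j → Set
      Admissibleᵗ t = Admissible c (last xs) (wT zero) (t zero)

      boundary : ∀ (h : Vector (Cod r j) (suc K′)) (t : Vector (Cod r j) (suc N′)) →
                 Increase (last (headLabels c xs)) (wT zero) (last h) (t zero)
                   ≡ Increase (c , last xs) (wT zero) (last h) (t zero)
      boundary h t = cong (λ w → Increase w (wT zero) (last h) (t zero)) (last-headLabels c xs)

    LocallyValid-split⁻ : ∀ h t → LocallyValid (headLabels c xs ⧺ wT) (h ⧺ t) →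
                          LocallyValid wT t × ChainIn xs (Admissibleᵗ t) h
    LocallyValid-split⁻ h t v with LocallyValid-⧺⁻ K′ (headLabels c xs) wT h t v
    ... | vH , inc , vT with LocallyValid-head⁻ c xs h vH
    ...   | tops , chain = vT , chain , λ i → tops i ,
              MayPrecede-≤ᶜ (c , last xs) (wT zero) (t zero) (Chain⇒≤ᶜlast xs h chain i)
                (Increase⇒MayPrecede (c , last xs) (wT zero) (last h) (t zero) (subst id (boundary h t) inc))

    LocallyValid-split⁺ : ∀ h t → LocallyValid wT t × ChainIn xs (Admissibleᵗ t) h →
                          LocallyValid (headLabels c xs ⧺ wT) (h ⧺ t)
    LocallyValid-split⁺ h t (vT , chain , adm) = LocallyValid-⧺⁺ K′ (headLabels c xs) wT h t
      ( LocallyValid-head⁺ c xs h (proj₁ ∘ adm) chain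
      , subst id (sym (boundary h t))
          (MayPrecede⇒Increase (c , last xs) (wT zero) (last h) (t zero) (proj₂ (last-∀ {P = Admissibleᵗ t} h adm)))
      , vT)

    count-LocallyValid-split :
      count (LocallyValid? (headLabels c xs ⧺ wT)) (allFns (suc K′ + suc N′) (allCod r j))
        ≡ sumBy (λ t → 𝟙 (LocallyValid? wT t)
                       * chainCount (suc K′) xs (count (Admissible? c (last xs) (wT zero) (t zero)) (allCod r j)))
                (allFns (suc N′) (allCod r j))
    count-LocallyValid-split = begin
      count (LocallyValid? (headLabels c xs ⧺ wT)) (allFns (suc K′ + suc N′) C)
        ≡⟨ count-allFns-⧺ C (suc K′) (suc N′) (LocallyValid? (headLabels c xs ⧺ wT)) ⟩
      sumBy (λ h → count (λ t → LocallyValid? (headLabels c xs ⧺ wT) (h ⧺ t)) Ts) Hs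
        ≡⟨ sumBy-cong (λ h → count-cong _ (λ t → LocallyValid? wT t ×-dec ChainIn? xs (Admissible?ᵗ t) h)
                                        (LocallyValid-split⁻ h) (LocallyValid-split⁺ h) Ts) Hs ⟩
      sumBy (λ h → sumBy (λ t → 𝟙 (LocallyValid? wT t ×-dec ChainIn? xs (Admissible?ᵗ t) h)) Ts) Hs
        ≡⟨ sumBy-swap (λ h t → 𝟙 (LocallyValid? wT t ×-dec ChainIn? xs (Admissible?ᵗ t) h)) Hs Ts ⟩
      sumBy (λ t → count (λ h → LocallyValid? wT t ×-dec ChainIn? xs (Admissible?ᵗ t) h) Hs) Ts
        ≡⟨ sumBy-cong (λ t → trans (count-const× (LocallyValid? wT t) (ChainIn? xs (Admissible?ᵗ t)) Hs)
                                   (cong (𝟙 (LocallyValid? wT t) *_) (count-ChainIn (suc K′) xs (Admissible?ᵗ t)))) Ts ⟩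
      sumBy (λ t → 𝟙 (LocallyValid? wT t) * chainCount (suc K′) xs (count (Admissible?ᵗ t) C)) Ts ∎
      where
      open ≡-Reasoning
      C : List (Cod r j)
      C = allCod r j
      Hs : List (Vector (Cod r j) (suc K′))
      Hs = allFns (suc K′) C
      Ts : List (Vector (Cod r j) (suc N′))
      Ts = allFns (suc N′) C
      Admissible?ᵗ : ∀ t → Decidable (Admissibleᵗ t)
      Admissible?ᵗ t = Admissible? c (last xs) (wT zero) (t zero)

-- shiftBy r (a , x) c = (rotate a , x): condition (iii) compares colours as residues a − c mod r.
module Rotation (r c : ℕ) .{{_ : NonZero r}} (c<r : c < r) where

  rotate : ℕ → ℕ
  rotate a = (a + (r ∸ c)) % r

  rotate-≥ : ∀ {a} → c ≤ a → a < r → rotate a ≡ a ∸ c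
  rotate-≥ {a} c≤a a<r = begin
    (a + (r ∸ c)) % r   ≡⟨ cong (_% r) (trans (sym (+-∸-assoc a (<⇒≤ c<r))) (+-∸-comm r c≤a)) ⟩
    (a ∸ c + r) % r     ≡⟨ [m+n]%n≡m%n (a ∸ c) r ⟩
    (a ∸ c) % r         ≡⟨ m<n⇒m%n≡m (≤-<-trans (m∸n≤m a c) a<r) ⟩
    a ∸ c               ∎
    where open ≡-Reasoning

  rotate-< : ∀ {a} → a < c → rotate a ≡ a + (r ∸ c)
  rotate-< {a} a<c = m<n⇒m%n≡m (≤-trans (+-monoˡ-< (r ∸ c) a<c) (≤-reflexive (m+[n∸m]≡n (<⇒≤ c<r))))

  rotate-wraps : ∀ {a b} → c ≤ a → a < r → b < c → rotate a < rotate b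
  rotate-wraps {a} {b} c≤a a<r b<c = subst₂ _<_ (sym (rotate-≥ c≤a a<r)) (sym (rotate-< b<c))
    (<-≤-trans (∸-monoˡ-< a<r c≤a) (m≤n+m (r ∸ c) b))

  rotate-mono-≥ : ∀ {a b} → c ≤ a → b < r → a < b → rotate a < rotate b
  rotate-mono-≥ {a} {b} c≤a b<r a<b = subst₂ _<_ (sym (rotate-≥ c≤a (<-trans a<b b<r)))
    (sym (rotate-≥ (≤-trans c≤a (<⇒≤ a<b)) b<r)) (∸-monoˡ-< a<b c≤a)

  rotate-mono-< : ∀ {a b} → b < c → a < b → rotate a < rotate b
  rotate-mono-< {a} {b} b<c a<b = subst₂ _<_ (sym (rotate-< (<-trans a<b b<c))) (sym (rotate-< b<c))
    (+-monoˡ-< (r ∸ c) a<b)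

  private
    tally : ∀ {w x y z} p q s t → w ≡ p → x ≡ q → y ≡ s → z ≡ t → p + q ≡ s + t → w + x ≡ y + z
    tally _ _ _ _ refl refl refl refl eq = eq

  rotate-balance : ∀ {a b} → a < r → b < r → a ≢ b → {B : Set} (B? : Dec B) →
    (rotate a < rotate b → B) → (rotate b < rotate a → ¬ B) →
    𝟙 (a <? c) + 𝟙 B? ≡ 𝟙 (b <? c) + 𝟙 (a <? b)
  rotate-balance {a} {b} a<r b<r a≢b B? before after with <-cmp a b | ≤-<-connex c a | ≤-<-connex c b
  ... | tri≈ _ a≡b _ | _ | _ = ⊥-elim (a≢b a≡b)
  ... | tri< a<b _ _ | inj₁ c≤a | inj₁ c≤b =
    tally 0 1 0 1 (𝟙-no (a <? c) (≤⇒≯ c≤a)) (𝟙-yes B? (before (rotate-mono-≥ c≤a b<r a<b)))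
                  (𝟙-no (b <? c) (≤⇒≯ c≤b)) (𝟙-yes (a <? b) a<b) refl
  ... | tri> _ _ b<a | inj₁ c≤a | inj₁ c≤b =
    tally 0 0 0 0 (𝟙-no (a <? c) (≤⇒≯ c≤a)) (𝟙-no B? (after (rotate-mono-≥ c≤b a<r b<a)))
                  (𝟙-no (b <? c) (≤⇒≯ c≤b)) (𝟙-no (a <? b) (<⇒≯ b<a)) refl
  ... | _ | inj₁ c≤a | inj₂ b<c =
    tally 0 1 1 0 (𝟙-no (a <? c) (≤⇒≯ c≤a)) (𝟙-yes B? (before (rotate-wraps c≤a a<r b<c)))
                  (𝟙-yes (b <? c) b<c) (𝟙-no (a <? b) (<⇒≯ (<-≤-trans b<c c≤a))) refl
  ... | _ | inj₂ a<c | inj₁ c≤b =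
    tally 1 0 0 1 (𝟙-yes (a <? c) a<c) (𝟙-no B? (after (rotate-wraps c≤b b<r a<c)))
                  (𝟙-no (b <? c) (≤⇒≯ c≤b)) (𝟙-yes (a <? b) (<-≤-trans a<c c≤b)) refl
  ... | tri< a<b _ _ | inj₂ a<c | inj₂ b<c =
    tally 1 1 1 1 (𝟙-yes (a <? c) a<c) (𝟙-yes B? (before (rotate-mono-< b<c a<b)))
                  (𝟙-yes (b <? c) b<c) (𝟙-yes (a <? b) a<b) refl
  ... | tri> _ _ b<a | inj₂ a<c | inj₂ b<c =
    tally 1 0 1 0 (𝟙-yes (a <? c) a<c) (𝟙-no B? (after (rotate-mono-< a<c b<a)))
                  (𝟙-yes (b <? c) b<c) (𝟙-no (a <? b) (<⇒≯ b<a)) refl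

module Endpoint (r j : ℕ) .{{_ : NonZero r}} where

  open Chains r j
  open Valid r j

  _≟ᶜ_ : DecidableEquality (Cod r j)
  _≟ᶜ_ = ≡-dec Fin._≟_ Fin._≟_

  count-≡-sorted : ∀ L → AllPairs _<ᶜ_ L → ∀ {e₀} → e₀ ∈ L → count (_≟ᶜ e₀) L ≡ 1
  count-≡-sorted (y ∷ L) (y< ∷ _) (here refl) =
    cong₂ _+_ (𝟙-yes (y ≟ᶜ y) refl)
      (trans (sumBy-cong-All (All.map (λ {e} y<e → 𝟙-no (e ≟ᶜ y) (λ { refl → <ℓ-irrefl y<e })) y<))
             (sumBy-zero L))
  count-≡-sorted (y ∷ L) (y< ∷ L-sorted) (there e₀∈L) =
    cong₂ _+_ (𝟙-no (y ≟ᶜ _) (λ { refl → <ℓ-irrefl (All.lookup y< e₀∈L) })) (count-≡-sorted L L-sorted e₀∈L)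

  count-≡× : ∀ e₀ {D : Set} (D? : Dec D) → count (λ e → (e ≟ᶜ e₀) ×-dec D?) (allCod r j) ≡ 𝟙 D?
  count-≡× e₀ D? = begin
    count (λ e → (e ≟ᶜ e₀) ×-dec D?) (allCod r j)
      ≡⟨ count-cong _ (λ e → D? ×-dec (e ≟ᶜ e₀)) (λ _ (p , q) → q , p) (λ _ (q , p) → p , q) (allCod r j) ⟩
    count (λ e → D? ×-dec (e ≟ᶜ e₀)) (allCod r j)
      ≡⟨ count-const× D? (_≟ᶜ e₀) (allCod r j) ⟩
    𝟙 D? * count (_≟ᶜ e₀) (allCod r j)
      ≡⟨ cong (𝟙 D? *_) (count-≡-sorted (allCod r j) allCod-sorted e₀∈allCod) ⟩
    𝟙 D? * 1
      ≡⟨ *-identityʳ (𝟙 D?) ⟩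
    𝟙 D? ∎
    where
    open ≡-Reasoning
    e₀∈allCod : e₀ ∈ allCod r j
    e₀∈allCod = ∈-cartesianProduct⁺ (∈-allFin (proj₁ e₀)) (∈-allFin (proj₂ e₀))

  top : Fin (suc j)
  top = fromℕ j

  top-maximal : ∀ (v : Fin (suc j)) → ¬ (toℕ top < toℕ v)
  top-maximal v top<v = <-irrefl refl (<-≤-trans (subst (_< toℕ v) (Fin.toℕ-fromℕ j) top<v) (s≤s⁻¹ (Fin.toℕ<n v)))

  BelowTop : Cod r j → Cod r j → Set
  BelowTop T e = toℕ (proj₂ e) ≢ j × e <ᶜ T

  BelowTop? : ∀ T → Decidable (BelowTop T)
  BelowTop? T e = ¬? (toℕ (proj₂ e) ≟ j) ×-dec (e <ᶜ? T)

  -- An admissible value is below T and not at height j, or is (c , j) below T, or is T itself.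
  module _ (c : Fin r) (x : ℕ) (w₁ : ℕ × ℕ) (T : Cod r j) where

    private
      AtTop AtT : Cod r j → Set
      AtTop e = e ≡ (c , top) × (c , top) <ᶜ T
      AtT   e = e ≡ T × (ColourAtTop (toℕ c) T × BoundaryOK (toℕ c , x) w₁ T)

      AtTop? : Decidable AtTop
      AtTop? e = (e ≟ᶜ (c , top)) ×-dec ((c , top) <ᶜ? T)

      AtT? : Decidable AtT
      AtT? e = (e ≟ᶜ T) ×-dec (ColourAtTop? (toℕ c) T ×-dec BoundaryOK? (toℕ c , x) w₁ T)

      split⁻ : ∀ e → Admissible (toℕ c) x w₁ T e → BelowTop T e ⊎ AtTop e ⊎ AtT e
      split⁻ e (colour , inj₂ (refl , ok)) = inj₂ (inj₂ (refl , colour , ok))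
      split⁻ e (colour , inj₁ e<T) with toℕ (proj₂ e) ≟ j
      ... | no  v≢j = inj₁ (v≢j , e<T)
      ... | yes v≡j = inj₂ (inj₁ (e≡top , subst (_<ᶜ T) e≡top e<T))
        where
        e≡top : e ≡ (c , top)
        e≡top = toP-injective (cong₂ _,_ (sym (colour v≡j)) (trans v≡j (sym (Fin.toℕ-fromℕ j))))

      split⁺ : ∀ e → BelowTop T e ⊎ AtTop e ⊎ AtT e → Admissible (toℕ c) x w₁ T e
      split⁺ e (inj₁ (v≢j , e<T))             = (λ v≡j → ⊥-elim (v≢j v≡j)) , inj₁ e<T
      split⁺ e (inj₂ (inj₁ (refl , e<T)))      = (λ _ → refl) , inj₁ e<T
      split⁺ e (inj₂ (inj₂ (refl , colour , ok))) = colour , inj₂ (refl , ok)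

      disjoint₁ : ∀ e → BelowTop T e → AtTop e ⊎ AtT e → ⊥
      disjoint₁ e (v≢j , _)  (inj₁ (refl , _)) = v≢j (Fin.toℕ-fromℕ j)
      disjoint₁ e (_ , e<T)  (inj₂ (refl , _)) = <ℓ-irrefl e<T

      disjoint₂ : ∀ e → AtTop e → AtT e → ⊥
      disjoint₂ e (refl , top<T) (refl , _) = <ℓ-irrefl top<T

    count-Admissible :
      count (Admissible? (toℕ c) x w₁ T) (allCod r j)
        ≡ count (BelowTop? T) (allCod r j)
          + (𝟙 ((c , top) <ᶜ? T) + 𝟙 (ColourAtTop? (toℕ c) T ×-dec BoundaryOK? (toℕ c , x) w₁ T))
    count-Admissible = begin
      count (Admissible? (toℕ c) x w₁ T) C
        ≡⟨ count-cong _ (λ e → BelowTop? T e ⊎-dec (AtTop? e ⊎-dec AtT? e)) split⁻ split⁺ C ⟩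
      count (λ e → BelowTop? T e ⊎-dec (AtTop? e ⊎-dec AtT? e)) C
        ≡⟨ count-⊎ (BelowTop? T) (λ e → AtTop? e ⊎-dec AtT? e) disjoint₁ C ⟩
      count (BelowTop? T) C + count (λ e → AtTop? e ⊎-dec AtT? e) C
        ≡⟨ cong (count (BelowTop? T) C +_) (count-⊎ AtTop? AtT? disjoint₂ C) ⟩
      count (BelowTop? T) C + (count AtTop? C + count AtT? C)
        ≡⟨ cong (λ n → count (BelowTop? T) C + n)
                (cong₂ _+_ (count-≡× (c , top) ((c , top) <ᶜ? T)) (count-≡× T _)) ⟩
      count (BelowTop? T) C
        + (𝟙 ((c , top) <ᶜ? T) + 𝟙 (ColourAtTop? (toℕ c) T ×-dec BoundaryOK? (toℕ c , x) w₁ T)) ∎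
      where
      open ≡-Reasoning
      C : List (Cod r j)
      C = allCod r j

  module _ (a b : Fin r) (a≢b : a ≢ b) (x y : ℕ)
           (b<a⇒y<x : toℕ b < toℕ a → y < x) (y<x⇒b<a : y < x → toℕ b < toℕ a) where

    private
      a≢b′ : toℕ a ≢ toℕ b
      a≢b′ = a≢b ∘ Fin.toℕ-injective

      BoundaryOK-b⇒a<b : ∀ T → BoundaryOK (toℕ b , x) (toℕ b , y) T → toℕ a < toℕ b
      BoundaryOK-b⇒a<b T ok with <-cmp (toℕ a) (toℕ b)
      ... | tri< a<b _ _ = a<b
      ... | tri≈ _ a≡b _ = ⊥-elim (a≢b′ a≡b)
      ... | tri> _ _ b<a = ⊥-elim (ok (inj₂ (refl , b<a⇒y<x b<a)))

      a<b⇒BoundaryOK-b : ∀ T → toℕ a < toℕ b → BoundaryOK (toℕ b , x) (toℕ b , y) T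
      a<b⇒BoundaryOK-b T a<b shifted = <-asym a<b (y<x⇒b<a (<ℓ-sameColour shifted))

      𝟙-top<ᶜ : ∀ (d c : Fin r) v → 𝟙 ((d , top) <ᶜ? (c , v)) ≡ 𝟙 (toℕ d <? toℕ c)
      𝟙-top<ᶜ d c v = 𝟙-cong ((d , top) <ᶜ? (c , v)) (toℕ d <? toℕ c)
        (λ { (inj₁ d<c) → d<c ; (inj₂ (_ , top<v)) → ⊥-elim (top-maximal v top<v) }) inj₁

      𝟙-BoundaryOK-b : ∀ T → ColourAtTop (toℕ b) T →
        𝟙 (ColourAtTop? (toℕ b) T ×-dec BoundaryOK? (toℕ b , x) (toℕ b , y) T) ≡ 𝟙 (toℕ a <? toℕ b)
      𝟙-BoundaryOK-b T colourT =
        𝟙-cong (ColourAtTop? (toℕ b) T ×-dec BoundaryOK? (toℕ b , x) (toℕ b , y) T) (toℕ a <? toℕ b)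
        (λ (_ , ok) → BoundaryOK-b⇒a<b T ok) (λ a<b → colourT , a<b⇒BoundaryOK-b T a<b)

    endpoint-balance : ∀ T → ColourAtTop (toℕ b) T →
      𝟙 ((a , top) <ᶜ? T) + 𝟙 (ColourAtTop? (toℕ a) T ×-dec BoundaryOK? (toℕ a , x) (toℕ b , y) T)
        ≡ 𝟙 ((b , top) <ᶜ? T) + 𝟙 (ColourAtTop? (toℕ b) T ×-dec BoundaryOK? (toℕ b , x) (toℕ b , y) T)
    endpoint-balance T@(c , v) colourT = by-height (toℕ v ≟ j)
      where
      Goal : Set
      Goal = 𝟙 ((a , top) <ᶜ? T) + 𝟙 (ColourAtTop? (toℕ a) T ×-dec BoundaryOK? (toℕ a , x) (toℕ b , y) T)
               ≡ 𝟙 ((b , top) <ᶜ? T) + 𝟙 (ColourAtTop? (toℕ b) T ×-dec BoundaryOK? (toℕ b , x) (toℕ b , y) T)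
      by-height : Dec (toℕ v ≡ j) → Goal
      by-height (yes v≡j) =
        trans (cong₂ _+_ a-top a-at-T) (trans (+-comm _ 0) (sym (cong₂ _+_ b-top (𝟙-BoundaryOK-b T colourT))))
        where
        b≡c : toℕ b ≡ toℕ c
        b≡c = colourT v≡j
        a-top : 𝟙 ((a , top) <ᶜ? T) ≡ 𝟙 (toℕ a <? toℕ b)
        a-top = trans (𝟙-top<ᶜ a c v) (cong (λ n → 𝟙 (toℕ a <? n)) (sym b≡c))
        a-at-T : 𝟙 (ColourAtTop? (toℕ a) T ×-dec BoundaryOK? (toℕ a , x) (toℕ b , y) T) ≡ 0
        a-at-T = 𝟙-no _ (λ (colour , _) → a≢b′ (trans (colour v≡j) (sym b≡c)))
        b-top : 𝟙 ((b , top) <ᶜ? T) ≡ 0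
        b-top = trans (𝟙-top<ᶜ b c v) (𝟙-no (toℕ b <? toℕ c) (<-irrefl b≡c))
      by-height (no v≢j) = begin
        𝟙 ((a , top) <ᶜ? T) + 𝟙 (ColourAtTop? (toℕ a) T ×-dec BoundaryOK? (toℕ a , x) (toℕ b , y) T)
          ≡⟨ cong₂ _+_ (𝟙-top<ᶜ a c v)
                       (𝟙-cong _ (BoundaryOK? (toℕ a , x) (toℕ b , y) T) proj₂ (λ ok → vacuous , ok)) ⟩
        𝟙 (toℕ a <? toℕ c) + 𝟙 (BoundaryOK? (toℕ a , x) (toℕ b , y) T)
          ≡⟨ rotate-balance (Fin.toℕ<n a) (Fin.toℕ<n b) a≢b′ (BoundaryOK? (toℕ a , x) (toℕ b , y) T) before after ⟩
        𝟙 (toℕ b <? toℕ c) + 𝟙 (toℕ a <? toℕ b)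
          ≡⟨ sym (cong₂ _+_ (𝟙-top<ᶜ b c v) (𝟙-BoundaryOK-b T colourT)) ⟩
        𝟙 ((b , top) <ᶜ? T) + 𝟙 (ColourAtTop? (toℕ b) T ×-dec BoundaryOK? (toℕ b , x) (toℕ b , y) T) ∎
        where
        open ≡-Reasoning
        open Rotation r (toℕ c) (Fin.toℕ<n c)
        vacuous : ColourAtTop (toℕ a) T
        vacuous v≡j = ⊥-elim (v≢j v≡j)
        before : rotate (toℕ a) < rotate (toℕ b) → BoundaryOK (toℕ a , x) (toℕ b , y) T
        before ra<rb (inj₁ rb<ra)      = <-asym ra<rb rb<ra
        before ra<rb (inj₂ (rb≡ra , _)) = <-irrefl (sym rb≡ra) ra<rb
        after : rotate (toℕ b) < rotate (toℕ a) → ¬ BoundaryOK (toℕ a , x) (toℕ b , y) T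
        after rb<ra ok = ok (inj₁ rb<ra)

    count-Admissible-recolour : ∀ T → ColourAtTop (toℕ b) T →
      count (Admissible? (toℕ a) x (toℕ b , y) T) (allCod r j)
        ≡ count (Admissible? (toℕ b) x (toℕ b , y) T) (allCod r j)
    count-Admissible-recolour T colourT =
      trans (count-Admissible a x (toℕ b , y) T)
        (trans (cong (count (BelowTop? T) (allCod r j) +_) (endpoint-balance T colourT))
               (sym (count-Admissible b x (toℕ b , y) T)))

module Partitions (r j : ℕ) .{{_ : NonZero r}} where

  open Chains r j
  open Valid r j

  record PairwiseValid {n} (w : Vector (ℕ × ℕ) n) (h : Vector (Cod r j) n) : Set where
    field
      weak   : ∀ s s′ → toℕ s < toℕ s′ → h s ≤ᶜ h s′
      strict : ∀ s s′ → toℕ s < toℕ s′ → proj₁ (h s) ≡ proj₁ (h s′) →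
               shiftBy r (w s′) (toℕ (proj₁ (h s))) <ℓ shiftBy r (w s) (toℕ (proj₁ (h s))) → h s <ᶜ h s′
      top    : ∀ s → ColourAtTop (proj₁ (w s)) (h s)

  open PairwiseValid

  PairwiseValid-tail : ∀ {n} {w : Vector (ℕ × ℕ) (suc n)} {h} → PairwiseValid w h → PairwiseValid (VF.tail w) (VF.tail h)
  PairwiseValid-tail v = record
    { weak   = λ s s′ s<s′ → weak v (suc s) (suc s′) (s≤s s<s′)
    ; strict = λ s s′ s<s′ → strict v (suc s) (suc s′) (s≤s s<s′)
    ; top    = λ s → top v (suc s) }

  PairwiseValid⇒LocallyValid : ∀ {n} (w : Vector (ℕ × ℕ) n) h → PairwiseValid w h → LocallyValid w h
  PairwiseValid⇒LocallyValid {zero}        w h v = tt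
  PairwiseValid⇒LocallyValid {suc zero}    w h v = top v zero
  PairwiseValid⇒LocallyValid {suc (suc n)} w h v =
    top v zero , (weak v zero (suc zero) (s≤s z≤n) , strict v zero (suc zero) (s≤s z≤n)) ,
    PairwiseValid⇒LocallyValid (VF.tail w) (VF.tail h) (PairwiseValid-tail v)

  PairwiseValid-cons : ∀ {n} (w : Vector (ℕ × ℕ) (suc (suc n))) h →
    ColourAtTop (proj₁ (w zero)) (h zero) → Increase (w zero) (w (suc zero)) (h zero) (h (suc zero)) →
    PairwiseValid (VF.tail w) (VF.tail h) → PairwiseValid w h
  PairwiseValid-cons w h top₀ (h₀≤h₁ , forced) v = record { weak = weak′ ; strict = strict′ ; top = top′ }
    where
    weak′ : ∀ s s′ → toℕ s < toℕ s′ → h s ≤ᶜ h s′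
    weak′ zero    (suc zero)     _   = h₀≤h₁
    weak′ zero    (suc (suc s′)) _   = ≤ℓ-trans h₀≤h₁ (weak v zero (suc s′) (s≤s z≤n))
    weak′ (suc s) (suc s′)       s<s′ = weak v s s′ (s≤s⁻¹ s<s′)

    -- If h₀ = h₁, condition (iii) for w₀ ≺ w₁ forces the shift of w₀ to be at most that of w₁,
    -- so the condition for w₁ ≺ w_{s′} applies.
    via-h₁ : ∀ {s′} → h zero ≤ᶜ h (suc zero) → proj₁ (h zero) ≡ proj₁ (h (suc (suc s′))) →
             shiftBy r (w (suc (suc s′))) (toℕ (proj₁ (h zero))) <ℓ shiftBy r (w zero) (toℕ (proj₁ (h zero))) →
             h zero <ᶜ h (suc (suc s′))
    via-h₁ {s′} (inj₁ h₀<h₁) _ _ = <-≤ℓ-trans h₀<h₁ (weak v zero (suc s′) (s≤s z≤n))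
    via-h₁ {s′} (inj₂ h₀≈h₁) c₀≡c′ shifted =
      subst (λ e → toP e <ℓ toP (h (suc (suc s′)))) (sym h₀≡h₁)
        (strict v zero (suc s′) (s≤s z≤n) (trans (sym (cong proj₁ h₀≡h₁)) c₀≡c′)
          (subst (λ c → shiftBy r (w (suc (suc s′))) c <ℓ shiftBy r (w (suc zero)) c) (cong (toℕ ∘ proj₁) h₀≡h₁)
            (<-≤ℓ-trans shifted w₀≤w₁)))
      where
      h₀≡h₁ : h zero ≡ h (suc zero)
      h₀≡h₁ = toP-injective {e = h zero} {h (suc zero)} h₀≈h₁
      w₀≤w₁ : shiftBy r (w zero) (toℕ (proj₁ (h zero))) ≤ℓ shiftBy r (w (suc zero)) (toℕ (proj₁ (h zero)))
      w₀≤w₁ = ≮ℓ⇒≥ℓ (λ shifted₁ →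
        <ℓ-irrefl (subst (_<ℓ toP (h (suc zero))) h₀≈h₁ (forced (cong proj₁ h₀≡h₁) shifted₁)))

    strict′ : ∀ s s′ → toℕ s < toℕ s′ → proj₁ (h s) ≡ proj₁ (h s′) →
              shiftBy r (w s′) (toℕ (proj₁ (h s))) <ℓ shiftBy r (w s) (toℕ (proj₁ (h s))) → h s <ᶜ h s′
    strict′ zero    (suc zero)     _    = forced
    strict′ (suc s) (suc s′)       s<s′ = strict v s s′ (s≤s⁻¹ s<s′)
    strict′ zero    (suc (suc s′)) _    = via-h₁ h₀≤h₁

    top′ : ∀ s → ColourAtTop (proj₁ (w s)) (h s)
    top′ zero    = top₀
    top′ (suc s) = top v s

  LocallyValid⇒PairwiseValid : ∀ {n} (w : Vector (ℕ × ℕ) n) h → LocallyValid w h → PairwiseValid w h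
  LocallyValid⇒PairwiseValid {zero}        w h _ = record { weak = λ () ; strict = λ () ; top = λ () }
  LocallyValid⇒PairwiseValid {suc zero}    w h v =
    record { weak = λ { zero zero () } ; strict = λ { zero zero () } ; top = λ { zero → v } }
  LocallyValid⇒PairwiseValid {suc (suc n)} w h (top₀ , inc , rest) =
    PairwiseValid-cons w h top₀ inc (LocallyValid⇒PairwiseValid (VF.tail w) (VF.tail h) rest)

  -- The chain 0₁ ≺ ⋯ ≺ 0_{r-1} of P(π) is all of P(π) for the empty coloured permutation.
  emptyPerm : ColPerm r 0
  emptyPerm = record { colour = λ () ; absP = Permutation.id }

  ZeroValid : Vector (Cod r j) (r ∸ 1) → Set
  ZeroValid g = IsColPPartition emptyPerm j (toMap g (λ ()))

  ZeroValid? : ∀ g → Dec (ZeroValid g)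
  ZeroValid? g = isColPPartition? emptyPerm j (toMap g (λ ()))

  module _ {n} (π : ColPerm r n) (g : Vector (Cod r j) (r ∸ 1)) (h : Vector (Cod r j) n) where

    IsColPPartition⇒split : IsColPPartition π j (toMap g h) → ZeroValid g × PairwiseValid (val π) h
    IsColPPartition⇒split p = zeros , letters
      where
      open IsColPPartition p
      zeros : ZeroValid g
      zeros = record
        { cond-i   = cond-i
        ; cond-ii  = λ { (zeroE t) (zeroE t′) → cond-ii (zeroE t) (zeroE t′) ; (letter ()) _ ; _ (letter ()) }
        ; cond-iii = λ { (zeroE t) (zeroE t′) → cond-iii (zeroE t) (zeroE t′) ; (letter ()) _ ; _ (letter ()) }
        ; cond-iv  = λ { (zeroE t) → cond-iv (zeroE t) ; (letter ()) } }
      letters : PairwiseValid (val π) h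
      letters = record
        { weak   = λ s s′ → cond-ii (letter s) (letter s′)
        ; strict = λ s s′ → cond-iii (letter s) (letter s′)
        ; top    = λ s → cond-iv (letter s) }

    split⇒IsColPPartition : ZeroValid g × PairwiseValid (val π) h → IsColPPartition π j (toMap g h)
    split⇒IsColPPartition (zeros , letters) = record
      { cond-i   = Z.cond-i
      ; cond-ii  = λ { (zeroE t) (zeroE t′) → Z.cond-ii (zeroE t) (zeroE t′)
                     ; (letter s) (letter s′) → weak letters s s′ }
      ; cond-iii = λ { (zeroE t) (zeroE t′) → Z.cond-iii (zeroE t) (zeroE t′)
                     ; (letter s) (letter s′) → strict letters s s′ }
      ; cond-iv  = λ { (zeroE t) → Z.cond-iv (zeroE t) ; (letter s) → top letters s } }
      where
      module Z = IsColPPartition zeros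

  Ω≡sumBy-ZeroValid : ∀ {n} (π : ColPerm r n) →
    Ω π j ≡ sumBy (λ g → 𝟙 (ZeroValid? g) * count (LocallyValid? (val π)) (allFns n (allCod r j)))
                  (allFns (r ∸ 1) (allCod r j))
  Ω≡sumBy-ZeroValid {n} π = begin
    Ω π j
      ≡⟨ length-filter≡count (isColPPartition? π j) (allMaps r n j) ⟩
    count (isColPPartition? π j) (allMaps r n j)
      ≡⟨ sumBy-map (λ f → 𝟙 (isColPPartition? π j f)) (λ gh → toMap {r} {n} (proj₁ gh) (proj₂ gh))
                   (cartesianProduct Gs Hs) ⟩
    sumBy (λ gh → 𝟙 (isColPPartition? π j (toMap (proj₁ gh) (proj₂ gh)))) (cartesianProduct Gs Hs)
      ≡⟨ sumBy-cartesianProduct _ Gs Hs ⟩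
    sumBy (λ g → count (λ h → isColPPartition? π j (toMap g h)) Hs) Gs
      ≡⟨ sumBy-cong (λ g → trans (count-cong _ (λ h → ZeroValid? g ×-dec LocallyValid? (val π) h) (to g) (from g) Hs)
                                 (count-const× (ZeroValid? g) (LocallyValid? (val π)) Hs)) Gs ⟩
    sumBy (λ g → 𝟙 (ZeroValid? g) * count (LocallyValid? (val π)) Hs) Gs ∎
    where
    open ≡-Reasoning
    Gs : List (Vector (Cod r j) (r ∸ 1))
    Gs = allFns (r ∸ 1) (allCod r j)
    Hs : List (Vector (Cod r j) n)
    Hs = allFns n (allCod r j)
    to : ∀ g h → IsColPPartition π j (toMap g h) → ZeroValid g × LocallyValid (val π) h
    to g h p with IsColPPartition⇒split π g h p
    ... | zeros , letters = zeros , PairwiseValid⇒LocallyValid (val π) h letters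
    from : ∀ g h → ZeroValid g × LocallyValid (val π) h → IsColPPartition π j (toMap g h)
    from g h (zeros , v) = split⇒IsColPPartition π g h (zeros , LocallyValid⇒PairwiseValid (val π) h v)

module _ {r n} (π : ColPerm r n) (k : Fin n) where

  colour-rho-< : ∀ s → toℕ s < toℕ k → colour (rho π k) s ≡ colour π k
  colour-rho-< s s<k with toℕ s <? toℕ k
  ... | yes _   = refl
  ... | no s≮k = ⊥-elim (s≮k s<k)

  colour-rho-≮ : ∀ s → ¬ toℕ s < toℕ k → colour (rho π k) s ≡ colour π s
  colour-rho-≮ s s≮k with toℕ s <? toℕ k
  ... | yes s<k = ⊥-elim (s≮k s<k)
  ... | no _    = refl

module _ {r n} .{{_ : NonZero r}} (π : ColPerm r n) where

  valExt-< : ∀ m (m<n : m < n) → valExt π m ≡ val π (fromℕ< m<n)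
  valExt-< m m<n with m <? n
  ... | yes m<n′ = cong (val π) (Fin.fromℕ<-cong m m refl m<n′ m<n)
  ... | no m≮n   = ⊥-elim (m≮n m<n)

  valExt-≮ : ∀ m → ¬ m < n → valExt π m ≡ zero₁ r
  valExt-≮ m m≮n with m <? n
  ... | yes m<n = ⊥-elim (m≮n m<n)
  ... | no _    = refl

sameColours-<ℓ : ∀ {p₁ p₀ q₁ q₀ : ℕ × ℕ} → proj₁ p₁ ≡ proj₁ p₀ → proj₁ q₁ ≡ proj₁ q₀ →
                 proj₂ p₁ ≡ proj₂ q₁ → proj₂ p₀ ≡ proj₂ q₀ → p₁ <ℓ p₀ → q₁ <ℓ q₀
sameColours-<ℓ refl q-same refl refl p₁<p₀ = inj₂ (q-same , <ℓ-sameColour p₁<p₀)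

module Descents (r : ℕ) .{{_ : NonZero r}} {n} (π : ColPerm r n) (k : Fin n) {K′} (k≡ : toℕ k ≡ suc K′)
                (same : ∀ s t → toℕ s < toℕ k → toℕ t < toℕ k → colour π s ≡ colour π t) where

  Descent : ColPerm r n → ℕ → Set
  Descent σ m = valExt σ (suc m) <ℓ valExt σ m

  private
    ρ : ColPerm r n
    ρ = rho π k

    K<n : suc K′ < n
    K<n = subst (_< n) k≡ (Fin.toℕ<n k)

    valExt-rho-≥ : ∀ m → suc K′ ≤ m → valExt ρ m ≡ valExt π m
    valExt-rho-≥ m K≤m = by-range (m <? n)
      where
      by-range : Dec (m < n) → valExt ρ m ≡ valExt π m
      by-range (no m≮n)  = trans (valExt-≮ ρ m m≮n) (sym (valExt-≮ π m m≮n))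
      by-range (yes m<n) = begin
        valExt ρ m            ≡⟨ valExt-< ρ m m<n ⟩
        val ρ (fromℕ< m<n)    ≡⟨ cong (λ c → toℕ c , proj₂ (val π (fromℕ< m<n))) (colour-rho-≮ π k _ after-k) ⟩
        val π (fromℕ< m<n)    ≡⟨ valExt-< π m m<n ⟨
        valExt π m            ∎
        where
        open ≡-Reasoning
        after-k : ¬ toℕ (fromℕ< m<n) < toℕ k
        after-k s<k = <⇒≱ s<k (subst₂ _≤_ (sym k≡) (sym (Fin.toℕ-fromℕ< m<n)) K≤m)

    descent-in-head : ∀ m → m < K′ → (Descent π m → Descent ρ m) × (Descent ρ m → Descent π m)
    descent-in-head m m<K′ = transfer refl colour-π colour-ρ , transfer refl colour-ρ colour-π
      where
      m+1<n : suc m < n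
      m+1<n = <-trans (s≤s m<K′) K<n
      m<n : m < n
      m<n = <-trans (n<1+n m) m+1<n
      s₁ s₀ : Fin n
      s₁ = fromℕ< m+1<n
      s₀ = fromℕ< m<n
      s₁<k : toℕ s₁ < toℕ k
      s₁<k = subst₂ _<_ (sym (Fin.toℕ-fromℕ< m+1<n)) (sym k≡) (s≤s m<K′)
      s₀<k : toℕ s₀ < toℕ k
      s₀<k = subst₂ _<_ (sym (Fin.toℕ-fromℕ< m<n)) (sym k≡) (<-trans m<K′ (n<1+n K′))
      colour-π : toℕ (colour π s₁) ≡ toℕ (colour π s₀)
      colour-π = cong toℕ (same s₁ s₀ s₁<k s₀<k)
      colour-ρ : toℕ (colour ρ s₁) ≡ toℕ (colour ρ s₀)
      colour-ρ = cong toℕ (trans (colour-rho-< π k s₁ s₁<k) (sym (colour-rho-< π k s₀ s₀<k)))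
      -- π and ρ have the same absolute values; within the head only those decide a descent.
      transfer : ∀ {σ τ} → absP σ ≡ absP τ →
                 toℕ (colour σ s₁) ≡ toℕ (colour σ s₀) → toℕ (colour τ s₁) ≡ toℕ (colour τ s₀) →
                 Descent σ m → Descent τ m
      transfer {σ} {τ} abs≡ σ-same τ-same d =
        subst₂ _<ℓ_ (sym (valExt-< τ (suc m) m+1<n)) (sym (valExt-< τ m m<n))
          (sameColours-<ℓ σ-same τ-same (absolute s₁) (absolute s₀)
            (subst₂ _<ℓ_ (valExt-< σ (suc m) m+1<n) (valExt-< σ m m<n) d))
        where
        absolute : ∀ s → proj₂ (val σ s) ≡ proj₂ (val τ s)
        absolute s = cong (λ p → suc (toℕ (p ⟨$⟩ʳ s))) abs≡

    descent-off-K′ : ∀ m → m ≢ K′ → (Descent π m → Descent ρ m) × (Descent ρ m → Descent π m)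
    descent-off-K′ m m≢K′ with <-cmp m K′
    ... | tri< m<K′ _ _ = descent-in-head m m<K′
    ... | tri≈ _ m≡K′ _ = ⊥-elim (m≢K′ m≡K′)
    ... | tri> _ _ K′<m =
      subst₂ _<ℓ_ (sym (valExt-rho-≥ (suc m) (<⇒≤ (s≤s K′<m)))) (sym (valExt-rho-≥ m K′<m)) ,
      subst₂ _<ℓ_ (valExt-rho-≥ (suc m) (<⇒≤ (s≤s K′<m))) (valExt-rho-≥ m K′<m)

  des-rho-≡⇒descent⇔ : des π ≡ des ρ → (Descent π K′ → Descent ρ K′) × (Descent ρ K′ → Descent π K′)
  des-rho-≡⇒descent⇔ des≡ =
    count-≡⇒⇔-at Descent?π Descent?ρ K′
      (λ m m≢K′ → proj₁ (descent-off-K′ m m≢K′)) (λ m m≢K′ → proj₂ (descent-off-K′ m m≢K′))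
      (upTo n) counts (∈-upTo⁺ (<-trans (n<1+n K′) K<n))
    where
    Descent?π : Decidable (Descent π)
    Descent?π m = valExt π (suc m) <ℓ? valExt π m
    Descent?ρ : Decidable (Descent ρ)
    Descent?ρ m = valExt ρ (suc m) <ℓ? valExt ρ m
    counts : count Descent?π (upTo n) ≡ count Descent?ρ (upTo n)
    counts = trans (sym (length-filter≡count Descent?π (upTo n))) (trans des≡ (length-filter≡count Descent?ρ (upTo n)))

module Recolouring (r j : ℕ) .{{_ : NonZero r}} where

  open Chains r j
  open Valid r j
  open Endpoint r j
  open Partitions r j

  count-recolour-head : ∀ {K′ N′} (xs : Vector ℕ (suc K′)) (wT : Vector (ℕ × ℕ) (suc N′))
    (a b : Fin r) → a ≢ b → ∀ y → wT zero ≡ (toℕ b , y) →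
    (toℕ b < toℕ a → y < last xs) → (y < last xs → toℕ b < toℕ a) →
    count (LocallyValid? (headLabels (toℕ a) xs ⧺ wT)) (allFns (suc K′ + suc N′) (allCod r j))
      ≡ count (LocallyValid? (headLabels (toℕ b) xs ⧺ wT)) (allFns (suc K′ + suc N′) (allCod r j))
  count-recolour-head {K′} {N′} xs wT a b a≢b y wT₀≡ b<a⇒y<x y<x⇒b<a =
    trans (count-LocallyValid-split (toℕ a) xs wT)
      (trans (sumBy-cong per-tail (allFns (suc N′) (allCod r j)))
             (sym (count-LocallyValid-split (toℕ b) xs wT)))
    where
    admissible : ℕ → Vector (Cod r j) (suc N′) → ℕ
    admissible c t = count (Admissible? c (last xs) (wT zero) (t zero)) (allCod r j)

    per-tail : ∀ t → 𝟙 (LocallyValid? wT t) * chainCount (suc K′) xs (admissible (toℕ a) t)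
                   ≡ 𝟙 (LocallyValid? wT t) * chainCount (suc K′) xs (admissible (toℕ b) t)
    per-tail t with LocallyValid? wT t
    ... | no _  = refl
    ... | yes v = cong (λ m → 1 * chainCount (suc K′) xs m)
      (subst (λ w → count (Admissible? (toℕ a) (last xs) w (t zero)) (allCod r j)
                      ≡ count (Admissible? (toℕ b) (last xs) w (t zero)) (allCod r j))
             (sym wT₀≡)
             (count-Admissible-recolour a b a≢b (last xs) y b<a⇒y<x y<x⇒b<a (t zero)
               (subst (λ w → ColourAtTop (proj₁ w) (t zero)) wT₀≡ (LocallyValid⇒ColourAtTop₀ wT t v))))

  module _ {K′ N′} (π : ColPerm r (suc K′ + suc N′)) (k : Fin (suc K′ + suc N′)) (k≡ : toℕ k ≡ suc K′)
           (same : ∀ s t → toℕ s < toℕ k → toℕ t < toℕ k → colour π s ≡ colour π t)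
           (differ : ∀ s → toℕ s < toℕ k → colour π s ≢ colour π k) where

    private
      K N : ℕ
      K = suc K′
      N = suc N′
      ρ : ColPerm r (K + N)
      ρ = rho π k
      a b : Fin r
      a = colour π zero
      b = colour π k

      head-<k : ∀ i → toℕ (i ↑ˡ N) < toℕ k
      head-<k i = subst₂ _<_ (sym (Fin.toℕ-↑ˡ i N)) (sym k≡) (Fin.toℕ<n i)

      tail-≮k : ∀ (i : Fin N) → ¬ toℕ (K ↑ʳ i) < toℕ k
      tail-≮k i s<k = <⇒≱ s<k (subst₂ _≤_ (sym k≡) (sym (Fin.toℕ-↑ʳ K i)) (m≤m+n K (toℕ i)))

      0<k : toℕ {K + N} zero < toℕ k
      0<k = head-<k zero

      xs : Vector ℕ K
      xs i = proj₂ (val π (i ↑ˡ N))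

      wT : Vector (ℕ × ℕ) N
      wT i = val π (K ↑ʳ i)

      y : ℕ
      y = proj₂ (val π k)

      val-π-split : ∀ i → val π i ≡ (headLabels (toℕ a) xs ⧺ wT) i
      val-π-split i = trans (⧺-split K (val π) i)
        (⧺-cong K (λ i → cong (λ c → toℕ c , xs i) (same (i ↑ˡ N) zero (head-<k i) 0<k)) (λ _ → refl) i)

      val-ρ-split : ∀ i → val ρ i ≡ (headLabels (toℕ b) xs ⧺ wT) i
      val-ρ-split i = trans (⧺-split K (val ρ) i)
        (⧺-cong K (λ i → cong (λ c → toℕ c , xs i) (colour-rho-< π k (i ↑ˡ N) (head-<k i)))
                  (λ i → cong (λ c → toℕ c , proj₂ (wT i)) (colour-rho-≮ π k (K ↑ʳ i) (tail-≮k i))) i)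

      wT₀≡ : wT zero ≡ (toℕ b , y)
      wT₀≡ = cong (val π) (Fin.toℕ-injective (trans (Fin.toℕ-↑ʳ K (zero {N′})) (trans (+-identityʳ K) (sym k≡))))

      K<n : K < K + N
      K<n = subst (_< K + N) k≡ (Fin.toℕ<n k)

      K′<n : K′ < K + N
      K′<n = <-trans (n<1+n K′) K<n

      k-1 : Fin (K + N)
      k-1 = fromℕ K′ ↑ˡ N

      k-1<k : toℕ k-1 < toℕ k
      k-1<k = head-<k (fromℕ K′)

      fromℕ<-K : fromℕ< K<n ≡ k
      fromℕ<-K = Fin.toℕ-injective (trans (Fin.toℕ-fromℕ< K<n) (sym k≡))

      fromℕ<-K′ : fromℕ< K′<n ≡ k-1
      fromℕ<-K′ = Fin.toℕ-injective
        (trans (Fin.toℕ-fromℕ< K′<n) (sym (trans (Fin.toℕ-↑ˡ (fromℕ K′) N) (Fin.toℕ-fromℕ K′))))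

      valExt-π-K : valExt π K ≡ (toℕ b , y)
      valExt-π-K = trans (valExt-< π K K<n) (cong (val π) fromℕ<-K)

      valExt-ρ-K : valExt ρ K ≡ (toℕ b , y)
      valExt-ρ-K = trans (valExt-< ρ K K<n)
        (trans (cong (val ρ) fromℕ<-K) (cong (λ c → toℕ c , y) (colour-rho-≮ π k k (<-irrefl refl))))

      valExt-π-K′ : valExt π K′ ≡ (toℕ a , last xs)
      valExt-π-K′ = trans (valExt-< π K′ K′<n) (trans (cong (val π) fromℕ<-K′)
        (cong₂ (λ c x → toℕ c , x) (same k-1 zero k-1<k 0<k) (sym (last≡fromℕ K′ xs))))

      valExt-ρ-K′ : valExt ρ K′ ≡ (toℕ b , last xs)
      valExt-ρ-K′ = trans (valExt-< ρ K′ K′<n) (trans (cong (val ρ) fromℕ<-K′)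
        (cong₂ (λ c x → toℕ c , x) (colour-rho-< π k k-1 k-1<k) (sym (last≡fromℕ K′ xs))))

    count-LocallyValid-rho : des π ≡ des ρ →
      count (LocallyValid? (val π)) (allFns (K + N) (allCod r j))
        ≡ count (LocallyValid? (val ρ)) (allFns (K + N) (allCod r j))
    count-LocallyValid-rho des≡ = begin
      count (LocallyValid? (val π)) Hs
        ≡⟨ count-cong _ _ (LocallyValid-resp val-π-split) (LocallyValid-resp (sym ∘ val-π-split)) Hs ⟩
      count (LocallyValid? (headLabels (toℕ a) xs ⧺ wT)) Hs
        ≡⟨ count-recolour-head xs wT a b (differ zero 0<k) y wT₀≡ b<a⇒y<x y<x⇒b<a ⟩
      count (LocallyValid? (headLabels (toℕ b) xs ⧺ wT)) Hs
        ≡⟨ count-cong _ _ (LocallyValid-resp (sym ∘ val-ρ-split)) (LocallyValid-resp val-ρ-split) Hs ⟩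
      count (LocallyValid? (val ρ)) Hs ∎
      where
      open ≡-Reasoning
      open Descents r π k k≡ same
      Hs : List (Vector (Cod r j) (K + N))
      Hs = allFns (K + N) (allCod r j)
      descent⇔ : (Descent π K′ → Descent ρ K′) × (Descent ρ K′ → Descent π K′)
      descent⇔ = des-rho-≡⇒descent⇔ des≡

      b<a⇒y<x : toℕ b < toℕ a → y < last xs
      b<a⇒y<x b<a = <ℓ-sameColour (subst₂ _<ℓ_ valExt-ρ-K valExt-ρ-K′
        (proj₁ descent⇔ (subst₂ _<ℓ_ (sym valExt-π-K) (sym valExt-π-K′) (inj₁ b<a))))

      y<x⇒b<a : y < last xs → toℕ b < toℕ a
      y<x⇒b<a y<x with subst₂ _<ℓ_ valExt-π-K valExt-π-K′
                         (proj₂ descent⇔ (subst₂ _<ℓ_ (sym valExt-ρ-K) (sym valExt-ρ-K′) (inj₂ (refl , y<x))))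
      ... | inj₁ b<a       = b<a
      ... | inj₂ (b≡a , _) = ⊥-elim (differ zero 0<k (Fin.toℕ-injective (sym b≡a)))

    Ω-rho : des π ≡ des ρ → Ω π j ≡ Ω ρ j
    Ω-rho des≡ = begin
      Ω π j
        ≡⟨ Ω≡sumBy-ZeroValid π ⟩
      sumBy (λ g → 𝟙 (ZeroValid? g) * count (LocallyValid? (val π)) Hs) Gs
        ≡⟨ sumBy-cong (λ g → cong (𝟙 (ZeroValid? g) *_) (count-LocallyValid-rho des≡)) Gs ⟩
      sumBy (λ g → 𝟙 (ZeroValid? g) * count (LocallyValid? (val ρ)) Hs) Gs
        ≡⟨ Ω≡sumBy-ZeroValid ρ ⟨
      Ω ρ j ∎
      where
      open ≡-Reasoning
      Gs : List (Vector (Cod r j) (r ∸ 1))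
      Gs = allFns (r ∸ 1) (allCod r j)
      Hs : List (Vector (Cod r j) (K + N))
      Hs = allFns (K + N) (allCod r j)

head-tail-sizes : ∀ {n} (k : Fin n) → 0 < toℕ k → ∃₂ λ K′ N′ → n ≡ suc K′ + suc N′ × toℕ k ≡ suc K′
head-tail-sizes {n} k 0<k = K′ , N′ , sym n≡ , k≡
  where
  K′ N′ : ℕ
  K′ = pred (toℕ k)
  N′ = n ∸ suc (toℕ k)
  k≡ : toℕ k ≡ suc K′
  k≡ = sym (suc-pred (toℕ k) {{>-nonZero 0<k}})
  n≡ : suc K′ + suc N′ ≡ n
  n≡ = begin
    suc K′ + suc N′       ≡⟨ +-suc (suc K′) N′ ⟩
    suc (suc K′ + N′)     ≡⟨ cong (λ m → suc (m + N′)) k≡ ⟨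
    suc (toℕ k) + N′      ≡⟨ m+[n∸m]≡n (Fin.toℕ<n k) ⟩
    n                     ∎
    where open ≡-Reasoning

mainTheorem6 : (r n : ℕ) .{{_ : NonZero r}} (π : ColPerm r n) →
    ¬ Monochromatic π →
    (k : Fin n) →
    0 < toℕ k →
    (∀ s t → toℕ s < toℕ k → toℕ t < toℕ k → colour π s ≡ colour π t) →
    (∀ s → toℕ s < toℕ k → colour π s ≢ colour π k) →
    des π ≡ des (rho π k) →
    (j : ℕ) → Ω π j ≡ Ω (rho π k) j
-- Non-monochromaticity is implied: the first letter and the letter at k differ in colour.
mainTheorem6 r n π _ k 0<k same differ des≡ j with head-tail-sizes k 0<k
... | K′ , N′ , refl , k≡ = Recolouring.Ω-rho r j π k k≡ same differ des≡
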